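{- Let $m$ be a positive integer, $V=\mathbb{F}_2^m$, and let $C=RM(1,m)\subseteq \mathbb{F}_2^V$ be the first-order Reed--Muller code (coordinates indexed by $V$), with dual code $C^\perp$. Let $T=\{0,u_1,u_2,u_3\}$ be a $4$-element subset of $V$ containing $0$. (1)(a) If $u_1+u_2\neq u_3$, then \begin{align*} J_{C,T}(w,z,x,y)=&w^4x^{2^m-4} + (2^{m-3}-1)w^4x^{2^{m-1}-4}y^{2^{m-1}} + 2^{m-1}w^3 z x^{2^{m-1}-3} y^{2^{m-1}-1} \\ &+ 3\cdot 2^{m-2}w^2z^2x^{2^{m-1}-2}y^{2^{m-1}-2}+ 2^{m-1}wz^3x^{2^{m-1}-1}y^{2^{m-1}-3}\\ &+ (2^{m-3}-1)z^4x^{2^{m-1}}y^{2^{m-1}-4}+ z^4y^{2^m-4}. \end{align*} (1)(b) If $u_1+u_2= u_3$, then \begin{align*} J_{C,T}(w,z,x,y)=&w^4x^{2^{m}-4} + (2^{m-2}-1)w^4x^{2^{m-1}-4}y^{2^{m-1}} + 3\cdot 2^{m-1}w^2z^2x^{2^{m-1}-2}y^{2^{m-1}-2} \\ &+ (2^{m-2}-1)z^4x^{2^{m-1}}y^{2^{m-1}-4} + z^4y^{2^{m}-4}. \end{align*} (2)(a) If $u_1+u_2\neq u_3$, then \begin{align*} J_{C^\perp,T}(w,z,x,y)=&\frac{1}{2^{m+1}}\Big((w+z)^4(x+y)^{2^m-4}+ (2^{m-3}-1)(w+z)^4(x+y)^{2^{m-1}-4}(x-y)^{2^{m-1}} \\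 &+ 2^{m-1}(w+z)^3 (w-z) (x+y)^{2^{m-1}-3} (x-y)^{2^{m-1}-1} \\ &+ 3\cdot 2^{m-2}(w+z)^2(w-z)^2(x+y)^{2^{m-1}-2}(x-y)^{2^{m-1}-2}\\ &+ 2^{m-1}(w+z)(w-z)^3(x+y)^{2^{m-1}-1}(x-y)^{2^{m-1}-3}\\ &+ (2^{m-3}-1)(w-z)^4(x+y)^{2^{m-1}}(x-y)^{2^{m-1}-4} + (w-z)^4(x-y)^{2^m-4}\Big). \end{align*} (2)(b) If $u_1+u_2= u_3$, then \begin{align*} J_{C^\perp,T}(w,z,x,y)=&\frac{1}{2^{m+1}}\Big((w+z)^4(x+y)^{2^{m}-4} + (2^{m-2}-1)(w+z)^4(x+y)^{2^{m-1}-4}(x-y)^{2^{m-1}} \\ &+ 3\cdot 2^{m-1}(w+z)^2(w-z)^2(x+y)^{2^{m-1}-2}(x-y)^{2^{m-1}-2} \\ &+ (2^{m-2}-1)(w-z)^4(x+y)^{2^{m-1}}(x-y)^{2^{m-1}-4} + (w-z)^4(x-y)^{2^{m}-4}\Big). \end{align*}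
   Context: $RM(1,m)=\{(\lambda(x)+b)_{x\in V}\mid \lambda\in \mathrm{Hom}(V,\mathbb{F}_2),\ b\in\mathbb{F}_2\}\subseteq \mathbb{F}_2^V$, a binary linear code of length $2^m$ whose coordinates are indexed by the points of $V$. The dual $C^\perp$ is taken with respect to the standard inner product $(x,y)=\sum_{v\in V}x_vy_v$. For a binary code $C$ with coordinate set $\Omega$ and $T\subseteq\Omega$, the Jacobi polynomial is $J_{C,T}(w,z,x,y)=\sum_{c\in C}w^{m_0(c)}z^{m_1(c)}x^{n_0(c)}y^{n_1(c)}$, where $m_i(c)=|\{j\in T\mid c_j=i\}|$ and $n_i(c)=|\{j\in \Omega\setminus T\mid c_j=i\}|$. -}

module Defs where

open import Level using (Level)
open import Data.Nat using (ℕ; zero; suc)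
import Data.Bool
open import Data.Bool using (Bool; true; false; _xor_; _∧_; not; if_then_else_)
open import Data.Vec using (Vec; []; _∷_; zipWith; replicate; foldr)
open import Data.Vec.Properties using (≡-dec)
open import Data.Bool.Properties using () renaming (_≟_ to _≟B_)
open import Data.List using (List; []; _∷_; [_]; concatMap; map; length; filterᵇ)
open import Relation.Nullary using (does; Dec)
open import Relation.Binary.PropositionalEquality using (_≡_)
import Data.List
open import Algebra.Bundles using (CommutativeRing)

-- F₂ is modelled by Bool: addition = xor, multiplication = ∧.

V : ℕ → Set
V m = Vec Bool m

_⊕_ : ∀ {m} → V m → V m → V m
_⊕_ = zipWith _xor_

0V : (m : ℕ) → V m
0V m = replicate m false

_≟V_ : ∀ {m} (u v : V m) → Dec (u ≡ v)
_≟V_ = ≡-dec _≟B_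

dot : ∀ {m} → V m → V m → Bool
dot a v = foldr _ _xor_ false (zipWith _∧_ a v)

allV : (m : ℕ) → List (V m)
allV zero = [ [] ]
allV (suc m) = concatMap (λ v → (false ∷ v) ∷ (true ∷ v) ∷ []) (allV m)

Word : ℕ → Set
Word m = V m → Bool

wordsOn : ∀ {m} → List (V m) → List (Word m)
wordsOn [] = [ (λ _ → false) ]
wordsOn (p ∷ ps) =
  concatMap (λ f → map (λ b → λ v → if does (v ≟V p) then b else f v) (false ∷ true ∷ []))
            (wordsOn ps)

allWords : (m : ℕ) → List (Word m)
allWords m = wordsOn (allV m)

-- RM(1,m) = { (λ(x)+b)_x | λ ∈ Hom(V,F₂), b ∈ F₂ }; every λ ∈ Hom(V,F₂) is
-- x ↦ a·x for a unique a ∈ V, so the codewords are listed (each once) by (a,b).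
RM1 : (m : ℕ) → List (Word m)
RM1 m = concatMap (λ a → map (λ b → λ x → dot a x xor b) (false ∷ true ∷ [])) (allV m)

inner : ∀ {m} → Word m → Word m → Bool
inner {m} c d = Data.List.foldr _xor_ false (map (λ v → c v ∧ d v) (allV m))

dual : ∀ {m} → List (Word m) → List (Word m)
dual {m} C = filterᵇ (λ c → Data.List.foldr (λ d r → not (inner c d) ∧ r) true C) (allWords m)

count : ∀ {m} → (V m → Bool) → ℕ
count {m} P = length (filterᵇ P (allV m))

module Jacobi {c ℓ : Level} (R : CommutativeRing c ℓ) where
  open CommutativeRing R

  pow : Carrier → ℕ → Carrier
  pow x zero = 1#
  pow x (suc n) = x * pow x n

  _·_ : ℕ → Carrier → Carrier
  zero · x = 0#
  suc n · x = x + (n · x)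

  sumR : List Carrier → Carrier
  sumR = Data.List.foldr _+_ 0#

  J : ∀ {m} → List (Word m) → (V m → Bool) → Carrier → Carrier → Carrier → Carrier → Carrier
  J C T w z x y = sumR (map mono C)
    where
      mono : _ → Carrier
      mono cw = pow w (count (λ v → T v ∧ not (cw v))) * pow z (count (λ v → T v ∧ cw v))
              * pow x (count (λ v → not (T v) ∧ not (cw v))) * pow y (count (λ v → not (T v) ∧ cw v))

setT : ∀ {m} → V m → V m → V m → V m → Bool
setT {m} u₁ u₂ u₃ v =
  Data.Bool._∨_ (does (v ≟V 0V m))
   (Data.Bool._∨_ (does (v ≟V u₁)) (Data.Bool._∨_ (does (v ≟V u₂)) (does (v ≟V u₃))))

-- The codewords of RM(1,m) are the affine functions v ↦ a·v + b. The two constant ones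
-- (a = 0) give w⁴x^(2^m-4) and z⁴y^(2^m-4); every other one has weight 2^(m-1), so its monomial
-- is determined by how many ones it has on T = {0, u₁, u₂, u₃}, which depends only on b and
-- (a·u₁, a·u₂, a·u₃). A character sum shows that for linearly independent u₁, …, uₖ the map
-- a ↦ (a·u₁, …, a·uₖ) takes every value of F₂^k exactly 2^(m-k) times; this is applied to
-- (u₁, u₂, u₃) when u₁ + u₂ ≠ u₃ and to (u₁, u₂) when u₃ = u₁ + u₂, and (1a), (1b) follow by
-- collecting monomials. Parts (2a), (2b) follow from the MacWilliams identity
-- 2^(m+1) J_{C^⊥,T}(w,z,x,y) = J_{C,T}(w+z, w-z, x+y, x-y), obtained by expanding
-- ∏_v (α_v + (-1)^(c_v) β_v) over all words and summing the characters of C.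

module Submission where

open import Defs
open import Data.Nat using (ℕ; zero; suc; _∸_; _≤_; z≤n; s≤s)
  renaming (_^_ to _^ℕ_; _*_ to _*ℕ_; _+_ to _+ℕ_)
import Data.Nat.Properties as ℕ
import Data.Integer as ℤ
import Data.Integer.Properties as ℤ
open import Data.Bool using (Bool; true; false; _xor_; _∧_; _∨_; not; if_then_else_)
import Data.Bool.Properties as Bool
open import Data.Vec using (Vec; []; _∷_)
open import Data.List using (List; []; _∷_; length; filterᵇ; concatMap; map)
open import Data.List.Relation.Unary.All using (All; []; _∷_)
open import Data.List.Relation.Unary.Unique.Propositional using (Unique; []; _∷_)
open import Data.Product using (_×_; _,_; proj₁; proj₂)
open import Relation.Nullary using (does; yes; no; Dec)
open import Relation.Nullary.Decidable using (dec-true; dec-false)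
open import Relation.Binary.PropositionalEquality
  using (_≡_; _≢_; refl; sym; trans; cong; cong₂; module ≡-Reasoning)
open import Algebra.Bundles using (CommutativeRing)
open import Level using (Level)
import Algebra.Properties.Ring
import Algebra.Properties.CommutativeSemigroup

xor-cancelˡ : ∀ a b → (a xor b) xor a ≡ b
xor-cancelˡ true true = refl
xor-cancelˡ true false = refl
xor-cancelˡ false b = Bool.xor-identityʳ b

open Algebra.Properties.CommutativeSemigroup
       (CommutativeRing.+-commutativeSemigroup Bool.xor-∧-commutativeRing)
  using () renaming (interchange to xor-interchange)

⊕-identityʳ : ∀ {m} (u : V m) → u ⊕ 0V m ≡ u
⊕-identityʳ [] = refl
⊕-identityʳ (b ∷ u) = cong₂ _∷_ (Bool.xor-identityʳ b) (⊕-identityʳ u)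

⊕-cancelˡ : ∀ {m} (u v : V m) → (u ⊕ v) ⊕ u ≡ v
⊕-cancelˡ [] [] = refl
⊕-cancelˡ (a ∷ u) (b ∷ v) = cong₂ _∷_ (xor-cancelˡ a b) (⊕-cancelˡ u v)

⊕≡0⇒≡ : ∀ {m} {u v : V m} → u ⊕ v ≡ 0V m → u ≡ v
⊕≡0⇒≡ {u = []} {[]} _ = refl
⊕≡0⇒≡ {u = a ∷ u} {b ∷ v} eq = cong₂ _∷_ (head-eq a b (cong Data.Vec.head eq)) (⊕≡0⇒≡ (cong Data.Vec.tail eq))
  where
  head-eq : ∀ a b → a xor b ≡ false → a ≡ b
  head-eq true true _ = refl
  head-eq false false _ = refl

⊕-same : ∀ {m} (u : V m) → u ⊕ u ≡ 0V m
⊕-same [] = refl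
⊕-same (a ∷ u) = cong₂ _∷_ (Bool.xor-same a) (⊕-same u)

dot-zeroʳ : ∀ {m} (a : V m) → dot a (0V m) ≡ false
dot-zeroʳ [] = refl
dot-zeroʳ (a ∷ as) rewrite Bool.∧-zeroʳ a = dot-zeroʳ as

dot-zeroˡ : ∀ {m} (v : V m) → dot (0V m) v ≡ false
dot-zeroˡ [] = refl
dot-zeroˡ (_ ∷ v) = dot-zeroˡ v

dot-comm : ∀ {m} (a v : V m) → dot a v ≡ dot v a
dot-comm [] [] = refl
dot-comm (a ∷ as) (b ∷ v) = cong₂ _xor_ (Bool.∧-comm a b) (dot-comm as v)

dot-distribʳ-⊕ : ∀ {m} (a u v : V m) → dot a (u ⊕ v) ≡ dot a u xor dot a v
dot-distribʳ-⊕ [] [] [] = refl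
dot-distribʳ-⊕ (false ∷ a) (_ ∷ u) (_ ∷ v) = dot-distribʳ-⊕ a u v
dot-distribʳ-⊕ (true ∷ a) (b ∷ u) (c ∷ v) rewrite dot-distribʳ-⊕ a u v =
  xor-interchange b c (dot a u) (dot a v)

toℕ : Bool → ℕ
toℕ false = 0
toℕ true = 1

countᵇ : ∀ {A : Set} → (A → Bool) → List A → ℕ
countᵇ P xs = length (filterᵇ P xs)

module _ {A : Set} where

  countᵇ-cong : ∀ {P Q : A → Bool} → (∀ a → P a ≡ Q a) → ∀ xs → countᵇ P xs ≡ countᵇ Q xs
  countᵇ-cong P≗Q [] = refl
  countᵇ-cong {P} {Q} P≗Q (a ∷ xs) with P a | Q a | P≗Q a
  ... | true  | true  | _ = cong suc (countᵇ-cong P≗Q xs)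
  ... | false | false | _ = countᵇ-cong P≗Q xs

  countᵇ-∷ : ∀ (P : A → Bool) a xs → countᵇ P (a ∷ xs) ≡ toℕ (P a) +ℕ countᵇ P xs
  countᵇ-∷ P a xs with P a
  ... | true  = refl
  ... | false = refl

  countᵇ-false : ∀ xs → countᵇ (λ (_ : A) → false) xs ≡ 0
  countᵇ-false [] = refl
  countᵇ-false (_ ∷ xs) = countᵇ-false xs

  countᵇ-true : ∀ xs → countᵇ (λ (_ : A) → true) xs ≡ length xs
  countᵇ-true [] = refl
  countᵇ-true (_ ∷ xs) = cong suc (countᵇ-true xs)

  countᵇ-split : ∀ (P Q : A → Bool) xs →
    countᵇ P xs ≡ countᵇ (λ a → Q a ∧ P a) xs +ℕ countᵇ (λ a → not (Q a) ∧ P a) xs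
  countᵇ-split P Q [] = refl
  countᵇ-split P Q (a ∷ xs) with P a | Q a
  ... | true  | true  = cong suc (countᵇ-split P Q xs)
  ... | true  | false = trans (cong suc (countᵇ-split P Q xs)) (sym (ℕ.+-suc _ _))
  ... | false | true  = countᵇ-split P Q xs
  ... | false | false = countᵇ-split P Q xs

  countᵇ-complement : ∀ (P : A → Bool) xs → countᵇ P xs +ℕ countᵇ (λ a → not (P a)) xs ≡ length xs
  countᵇ-complement P xs = begin
    countᵇ P xs +ℕ countᵇ (λ a → not (P a)) xs
      ≡⟨ sym (cong₂ _+ℕ_ (countᵇ-cong (λ a → Bool.∧-identityʳ (P a)) xs)
                          (countᵇ-cong (λ a → Bool.∧-identityʳ (not (P a))) xs)) ⟩
    countᵇ (λ a → P a ∧ true) xs +ℕ countᵇ (λ a → not (P a) ∧ true) xs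
      ≡⟨ sym (countᵇ-split (λ _ → true) P xs) ⟩
    countᵇ (λ _ → true) xs
      ≡⟨ countᵇ-true xs ⟩
    length xs ∎
    where open ≡-Reasoning

  countᵇ-∨ : ∀ (E F Q : A → Bool) → (∀ a → E a ≡ true → F a ≡ false) → ∀ xs →
    countᵇ (λ a → (E a ∨ F a) ∧ Q a) xs ≡ countᵇ (λ a → E a ∧ Q a) xs +ℕ countᵇ (λ a → F a ∧ Q a) xs
  countᵇ-∨ E F Q disjoint [] = refl
  countᵇ-∨ E F Q disjoint (a ∷ xs) with E a | F a | Q a | disjoint a
  ... | true  | true  | _     | E⇒¬F with () ← E⇒¬F refl
  ... | true  | false | true  | _ = cong suc (countᵇ-∨ E F Q disjoint xs)
  ... | true  | false | false | _ = countᵇ-∨ E F Q disjoint xs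
  ... | false | true  | true  | _ = trans (cong suc (countᵇ-∨ E F Q disjoint xs)) (sym (ℕ.+-suc _ _))
  ... | false | true  | false | _ = countᵇ-∨ E F Q disjoint xs
  ... | false | false | _     | _ = countᵇ-∨ E F Q disjoint xs

extendBoth : ∀ {m} → V m → List (V (suc m))
extendBoth v = (false ∷ v) ∷ (true ∷ v) ∷ []

countᵇ-extendBoth : ∀ {m} (P : V (suc m) → Bool) (vs : List (V m)) →
  countᵇ P (concatMap extendBoth vs) ≡ countᵇ (λ v → P (false ∷ v)) vs +ℕ countᵇ (λ v → P (true ∷ v)) vs
countᵇ-extendBoth P [] = refl
countᵇ-extendBoth P (v ∷ vs)
  rewrite countᵇ-∷ P (false ∷ v) ((true ∷ v) ∷ concatMap extendBoth vs)
        | countᵇ-∷ P (true ∷ v) (concatMap extendBoth vs)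
        | countᵇ-extendBoth P vs
        | countᵇ-∷ (λ v → P (false ∷ v)) v vs
        | countᵇ-∷ (λ v → P (true ∷ v)) v vs
  = trans (sym (ℕ.+-assoc a b (c +ℕ d))) (interchange a b c d)
  where
  open Algebra.Properties.CommutativeSemigroup ℕ.+-commutativeSemigroup using (interchange)
  a = toℕ (P (false ∷ v))
  b = toℕ (P (true ∷ v))
  c = countᵇ (λ v → P (false ∷ v)) vs
  d = countᵇ (λ v → P (true ∷ v)) vs

length-allV : ∀ m → length (allV m) ≡ 2 ^ℕ m
length-allV zero = refl
length-allV (suc m) = begin
  length (allV (suc m))
    ≡⟨ sym (countᵇ-true (allV (suc m))) ⟩
  countᵇ (λ _ → true) (concatMap extendBoth (allV m))
    ≡⟨ countᵇ-extendBoth (λ _ → true) (allV m) ⟩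
  countᵇ (λ _ → true) (allV m) +ℕ countᵇ (λ _ → true) (allV m)
    ≡⟨ cong (λ n → n +ℕ n) (trans (countᵇ-true (allV m)) (length-allV m)) ⟩
  2 ^ℕ m +ℕ 2 ^ℕ m
    ≡⟨ cong (2 ^ℕ m +ℕ_) (sym (ℕ.+-identityʳ (2 ^ℕ m))) ⟩
  2 ^ℕ suc m ∎
  where open ≡-Reasoning

count-≟ : ∀ {m} (p : V m) → count (λ v → does (v ≟V p)) ≡ 1
count-≟ [] = refl
count-≟ {suc m} (false ∷ p) rewrite countᵇ-extendBoth (λ v → does (v ≟V (false ∷ p))) (allV m)
  = cong₂ _+ℕ_ (count-≟ p) (countᵇ-false (allV m))
count-≟ {suc m} (true ∷ p) rewrite countᵇ-extendBoth (λ v → does (v ≟V (true ∷ p))) (allV m)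
  = trans (cong (_+ℕ countᵇ (λ v → does (v ≟V p)) (allV m)) (countᵇ-false (allV m))) (count-≟ p)

unique-allV : ∀ m → Unique (allV m)
unique-allV zero = [] ∷ []
unique-allV (suc m) = extendBoth-unique (unique-allV m)
  where
  cons-≢ : ∀ {n} {b} {v : V n} {vs} → All (v ≢_) vs → All (λ u → b ∷ v ≢ u) (concatMap extendBoth vs)
  cons-≢ [] = []
  cons-≢ (v≢u ∷ v∉) = (λ eq → v≢u (cong Data.Vec.tail eq)) ∷ (λ eq → v≢u (cong Data.Vec.tail eq)) ∷ cons-≢ v∉
  extendBoth-unique : ∀ {n} {vs : List (V n)} → Unique vs → Unique (concatMap extendBoth vs)
  extendBoth-unique [] = []
  extendBoth-unique (v∉ ∷ u) = ((λ ()) ∷ cons-≢ v∉) ∷ cons-≢ v∉ ∷ extendBoth-unique u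

affine : ∀ {m} → V m → Bool → Word m
affine a b v = dot a v xor b

count-affine : ∀ {m} (a : V m) b → a ≢ 0V m → count (affine a b) ≡ 2 ^ℕ (m ∸ 1)
count-affine [] b a≢0 with () ← a≢0 refl
count-affine {suc m} (true ∷ a) b _ rewrite countᵇ-extendBoth (affine (true ∷ a) b) (allV m) = begin
  count (affine a b) +ℕ count (λ v → not (dot a v) xor b)
    ≡⟨ cong (count (affine a b) +ℕ_)
         (countᵇ-cong (λ v → sym (Bool.not-distribˡ-xor (dot a v) b)) (allV m)) ⟩
  count (affine a b) +ℕ count (λ v → not (affine a b v))
    ≡⟨ countᵇ-complement (affine a b) (allV m) ⟩
  length (allV m)
    ≡⟨ length-allV m ⟩
  2 ^ℕ m ∎
  where open ≡-Reasoning
count-affine {suc zero} (false ∷ []) b a≢0 with () ← a≢0 refl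
count-affine {suc (suc m)} (false ∷ a) b a≢0
  rewrite countᵇ-extendBoth (affine (false ∷ a) b) (allV (suc m))
        | count-affine a b (λ a≡0 → a≢0 (cong (false ∷_) a≡0))
  = cong (2 ^ℕ m +ℕ_) (sym (ℕ.+-identityʳ (2 ^ℕ m)))

innerOn : ∀ {m} → List (V m) → Word m → Word m → Bool
innerOn vs c d = Data.List.foldr _xor_ false (map (λ v → c v ∧ d v) vs)

pointSumOn : ∀ {m} → List (V m) → Word m → V m
pointSumOn {m} vs d = Data.List.foldr (λ v r → (if d v then v else 0V m) ⊕ r) (0V m) vs

parityOn : ∀ {m} → List (V m) → Word m → Bool
parityOn vs d = Data.List.foldr (λ v r → d v xor r) false vs

innerOn-comm : ∀ {m} (vs : List (V m)) c d → innerOn vs c d ≡ innerOn vs d c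
innerOn-comm [] c d = refl
innerOn-comm (v ∷ vs) c d = cong₂ _xor_ (Bool.∧-comm (c v) (d v)) (innerOn-comm vs c d)

innerOn-dot : ∀ {m} (vs : List (V m)) (a : V m) d → innerOn vs (dot a) d ≡ dot a (pointSumOn vs d)
innerOn-dot {m} [] a d = sym (dot-zeroʳ a)
innerOn-dot (v ∷ vs) a d with d v
... | true  = trans (cong₂ _xor_ (Bool.∧-identityʳ (dot a v)) (innerOn-dot vs a d))
                    (sym (dot-distribʳ-⊕ a v (pointSumOn vs d)))
... | false = trans (cong₂ _xor_ (Bool.∧-zeroʳ (dot a v)) (innerOn-dot vs a d))
                    (sym (trans (dot-distribʳ-⊕ a _ (pointSumOn vs d))
                                (cong (_xor dot a (pointSumOn vs d)) (dot-zeroʳ a))))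

innerOn-xor : ∀ {m} (vs : List (V m)) (f : Word m) b d →
  innerOn vs (λ v → f v xor b) d ≡ innerOn vs f d xor (b ∧ parityOn vs d)
innerOn-xor [] f b d = sym (Bool.∧-zeroʳ b)
innerOn-xor (v ∷ vs) f b d = begin
  ((f v xor b) ∧ d v) xor innerOn vs (λ v → f v xor b) d
    ≡⟨ cong₂ _xor_ (Bool.∧-distribʳ-xor (d v) (f v) b) (innerOn-xor vs f b d) ⟩
  ((f v ∧ d v) xor (b ∧ d v)) xor (innerOn vs f d xor (b ∧ parityOn vs d))
    ≡⟨ xor-interchange (f v ∧ d v) (b ∧ d v) _ _ ⟩
  ((f v ∧ d v) xor innerOn vs f d) xor ((b ∧ d v) xor (b ∧ parityOn vs d))
    ≡⟨ cong (((f v ∧ d v) xor innerOn vs f d) xor_) (sym (Bool.∧-distribˡ-xor b (d v) (parityOn vs d))) ⟩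
  ((f v ∧ d v) xor innerOn vs f d) xor (b ∧ (d v xor parityOn vs d)) ∎
  where open ≡-Reasoning

inner-affine : ∀ {m} (a : V m) b (d : Word m) →
  inner (affine a b) d ≡ dot a (pointSumOn (allV m) d) xor (b ∧ parityOn (allV m) d)
inner-affine {m} a b d = trans (innerOn-xor (allV m) (dot a) b d) (cong (_xor _) (innerOn-dot (allV m) a d))

orthogonalTo : ∀ {m} → List (Word m) → Word m → Bool
orthogonalTo C d = Data.List.foldr (λ c r → not (inner d c) ∧ r) true C

orthogonal-RM1 : ∀ {m} (d : Word m) → pointSumOn (allV m) d ≡ 0V m → parityOn (allV m) d ≡ false →
  orthogonalTo (RM1 m) d ≡ true
orthogonal-RM1 {m} d S≡0 P≡false = go (allV m)
  where
  d⊥affine : ∀ a b → inner d (affine a b) ≡ false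
  d⊥affine a b = begin
    inner d (affine a b)                                      ≡⟨ innerOn-comm (allV m) d (affine a b) ⟩
    inner (affine a b) d                                      ≡⟨ inner-affine a b d ⟩
    dot a (pointSumOn (allV m) d) xor (b ∧ parityOn (allV m) d) ≡⟨ cong₂ (λ s p → dot a s xor (b ∧ p)) S≡0 P≡false ⟩
    dot a (0V m) xor (b ∧ false)                              ≡⟨ cong₂ _xor_ (dot-zeroʳ a) (Bool.∧-zeroʳ b) ⟩
    false                                                     ∎
    where open ≡-Reasoning
  go : ∀ as → orthogonalTo (concatMap (λ a → map (affine a) (false ∷ true ∷ [])) as) d ≡ true
  go [] = refl
  go (a ∷ as) rewrite d⊥affine a false | d⊥affine a true = go as

length-RM1 : ∀ m → length (RM1 m) ≡ 2 ^ℕ (m +ℕ 1)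
length-RM1 m = begin
  length (RM1 m)                      ≡⟨ length-bits (allV m) affine ⟩
  length (allV m) +ℕ length (allV m)  ≡⟨ cong (λ n → n +ℕ n) (length-allV m) ⟩
  2 ^ℕ m +ℕ 2 ^ℕ m                    ≡⟨ cong (2 ^ℕ m +ℕ_) (sym (ℕ.+-identityʳ (2 ^ℕ m))) ⟩
  2 ^ℕ (1 +ℕ m)                       ≡⟨ cong (2 ^ℕ_) (ℕ.+-comm 1 m) ⟩
  2 ^ℕ (m +ℕ 1)                       ∎
  where
  open ≡-Reasoning
  length-bits : ∀ {A : Set} (xs : List (V m)) (g : V m → Bool → A) →
    length (concatMap (λ a → map (g a) (false ∷ true ∷ [])) xs) ≡ length xs +ℕ length xs
  length-bits [] g = refl
  length-bits (a ∷ xs) g = cong suc (trans (cong suc (length-bits xs g)) (sym (ℕ.+-suc _ _)))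

-- Linear independence

dots : ∀ {m k} → V m → Vec (V m) k → V k
dots a = Data.Vec.map (dot a)

dots-zero : ∀ {m k} (us : Vec (V m) k) → dots (0V m) us ≡ 0V k
dots-zero [] = refl
dots-zero (u ∷ us) = cong₂ _∷_ (dot-zeroˡ u) (dots-zero us)

combination : ∀ {m k} → V k → Vec (V m) k → V m
combination {m} [] [] = 0V m
combination (σ ∷ σs) (u ∷ us) = if σ then u ⊕ combination σs us else combination σs us

dot-combination : ∀ {m k} (a : V m) (σ : V k) (us : Vec (V m) k) →
  dot a (combination σ us) ≡ dot σ (dots a us)
dot-combination a [] [] = dot-zeroʳ a
dot-combination a (true ∷ σ) (u ∷ us) =
  trans (dot-distribʳ-⊕ a u _) (cong (dot a u xor_) (dot-combination a σ us))
dot-combination a (false ∷ σ) (u ∷ us) = dot-combination a σ us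

combination-zero : ∀ {m k} (us : Vec (V m) k) → combination (0V k) us ≡ 0V m
combination-zero [] = refl
combination-zero (u ∷ us) = combination-zero us

Independent : ∀ {m k} → Vec (V m) k → Set
Independent {m} {k} us = ∀ σ → combination σ us ≡ 0V m → σ ≡ 0V k

independent-[] : ∀ {m} → Independent {m} []
independent-[] [] _ = refl

independent-∷ : ∀ {m k} {u : V m} {us : Vec (V m) k} →
  Independent us → (∀ σ → u ≢ combination σ us) → Independent (u ∷ us)
independent-∷ ind u∉span (true ∷ σ) u+c≡0 with () ← u∉span σ (⊕≡0⇒≡ u+c≡0)
independent-∷ ind u∉span (false ∷ σ) c≡0 = cong (false ∷_) (ind σ c≡0)

2^k*c≡2^m⇒ : ∀ k m c → 2 ^ℕ k *ℕ c ≡ 2 ^ℕ m → k ≤ m × c ≡ 2 ^ℕ (m ∸ k)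
2^k*c≡2^m⇒ zero m c eq = z≤n , trans (sym (ℕ.+-identityʳ c)) eq
2^k*c≡2^m⇒ (suc k) zero c eq with () ← ℕ.m*n≡1⇒m≡1 2 (2 ^ℕ k) (ℕ.m*n≡1⇒m≡1 (2 ^ℕ suc k) c eq)
2^k*c≡2^m⇒ (suc k) (suc m) c eq
  with 2^k*c≡2^m⇒ k m c (ℕ.*-cancelˡ-≡ _ _ 2 (trans (sym (ℕ.*-assoc 2 (2 ^ℕ k) c)) eq))
... | k≤m , c≡ = s≤s k≤m , c≡

4*2^[m∸3]≡2^[m∸1] : ∀ {m} → 3 ≤ m → 4 *ℕ 2 ^ℕ (m ∸ 3) ≡ 2 ^ℕ (m ∸ 1)
4*2^[m∸3]≡2^[m∸1] (s≤s (s≤s (s≤s {n = d} _))) = ℕ.*-assoc 2 2 (2 ^ℕ d)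

6*2^[m∸3]≡3*2^[m∸2] : ∀ {m} → 3 ≤ m → 6 *ℕ 2 ^ℕ (m ∸ 3) ≡ 3 *ℕ 2 ^ℕ (m ∸ 2)
6*2^[m∸3]≡3*2^[m∸2] (s≤s (s≤s (s≤s {n = d} _))) = ℕ.*-assoc 3 2 (2 ^ℕ d)

6*2^[m∸2]≡3*2^[m∸1] : ∀ {m} → 2 ≤ m → 6 *ℕ 2 ^ℕ (m ∸ 2) ≡ 3 *ℕ 2 ^ℕ (m ∸ 1)
6*2^[m∸2]≡3*2^[m∸1] (s≤s (s≤s {n = d} _)) = ℕ.*-assoc 3 2 (2 ^ℕ d)

2^≡suc[2^∸1] : ∀ j → 2 ^ℕ j ≡ suc (2 ^ℕ j ∸ 1)
2^≡suc[2^∸1] j = sym (ℕ.m+[n∸m]≡n (ℕ.m^n>0 2 j))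

module RingSums {c ℓ : Level} (R : CommutativeRing c ℓ) where

  open CommutativeRing R renaming (refl to ≈-refl; sym to ≈-sym; trans to ≈-trans)
  open Jacobi R public
  open import Relation.Binary.Reasoning.Setoid setoid
  open Algebra.Properties.CommutativeSemigroup +-commutativeSemigroup using (interchange)
  open Algebra.Properties.Ring ring using (+-cancelʳ)
  open import Algebra.Solver.CommutativeMonoid +-commutativeMonoid using (solve; _⊜_) renaming (_⊕_ to _⊞_)

  ≡⇒≈ : ∀ {a b} → a ≡ b → a ≈ b
  ≡⇒≈ refl = ≈-refl

  -- _·_ is Algebra.Definitions.RawMonoid._×_ clause for clause, but a different name,
  -- so the library's laws for _×_ do not apply to it.

  ·-congʳ : ∀ n {a b} → a ≈ b → n · a ≈ n · b
  ·-congʳ zero a≈b = ≈-refl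
  ·-congʳ (suc n) a≈b = +-cong a≈b (·-congʳ n a≈b)

  ·-congˡ : ∀ {m n} a → m ≡ n → m · a ≈ n · a
  ·-congˡ a refl = ≈-refl

  ·-homo-+ : ∀ m n a → (m +ℕ n) · a ≈ m · a + n · a
  ·-homo-+ zero n a = ≈-sym (+-identityˡ _)
  ·-homo-+ (suc m) n a = ≈-trans (+-cong ≈-refl (·-homo-+ m n a)) (≈-sym (+-assoc _ _ _))

  ·-assoc : ∀ m n a → (m *ℕ n) · a ≈ m · (n · a)
  ·-assoc zero n a = ≈-refl
  ·-assoc (suc m) n a = ≈-trans (·-homo-+ n (m *ℕ n) a) (+-cong ≈-refl (·-assoc m n a))

  ·-distrib-+ : ∀ n a b → n · (a + b) ≈ n · a + n · b
  ·-distrib-+ zero a b = ≈-sym (+-identityʳ _)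
  ·-distrib-+ (suc n) a b = ≈-trans (+-cong ≈-refl (·-distrib-+ n a b)) (interchange a b (n · a) (n · b))

  ·-zero : ∀ n → n · 0# ≈ 0#
  ·-zero zero = ≈-refl
  ·-zero (suc n) = ≈-trans (+-identityˡ _) (·-zero n)

  ·-*-assoc : ∀ n a b → (n · a) * b ≈ n · (a * b)
  ·-*-assoc zero a b = zeroˡ b
  ·-*-assoc (suc n) a b = ≈-trans (distribʳ b a (n · a)) (+-cong ≈-refl (·-*-assoc n a b))

  ·≈·1#* : ∀ n a → n · a ≈ (n · 1#) * a
  ·≈·1#* n a = ≈-trans (·-congʳ n (≈-sym (*-identityˡ a))) (≈-sym (·-*-assoc n 1# a))

  ·-*ℕ-comm : ∀ a k x → (a *ℕ k) · x ≈ k · (a · x)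
  ·-*ℕ-comm a k x = ≈-trans (·-congˡ x (ℕ.*-comm a k)) (·-assoc k a x)

  ∑ : ∀ {A : Set} → List A → (A → Carrier) → Carrier
  ∑ xs f = sumR (map f xs)

  syntax ∑ xs (λ a → e) = ∑[ a ∈ xs ] e

  module _ {A : Set} where

    ∑-cong : ∀ (xs : List A) {f g : A → Carrier} → (∀ a → f a ≈ g a) → ∑ xs f ≈ ∑ xs g
    ∑-cong [] f≈g = ≈-refl
    ∑-cong (a ∷ xs) f≈g = +-cong (f≈g a) (∑-cong xs f≈g)

    ∑-+ : ∀ (xs : List A) f g → ∑[ a ∈ xs ] (f a + g a) ≈ ∑ xs f + ∑ xs g
    ∑-+ [] f g = ≈-sym (+-identityʳ _)
    ∑-+ (a ∷ xs) f g = ≈-trans (+-cong ≈-refl (∑-+ xs f g)) (interchange _ _ _ _)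

    ∑-*ˡ : ∀ (xs : List A) k f → ∑[ a ∈ xs ] (k * f a) ≈ k * ∑ xs f
    ∑-*ˡ [] k f = ≈-sym (zeroʳ k)
    ∑-*ˡ (a ∷ xs) k f = ≈-trans (+-cong ≈-refl (∑-*ˡ xs k f)) (≈-sym (distribˡ k _ _))

    ∑-*ʳ : ∀ (xs : List A) k f → ∑[ a ∈ xs ] (f a * k) ≈ ∑ xs f * k
    ∑-*ʳ [] k f = ≈-sym (zeroˡ k)
    ∑-*ʳ (a ∷ xs) k f = ≈-trans (+-cong ≈-refl (∑-*ʳ xs k f)) (≈-sym (distribʳ k _ _))

    ∑-·ˡ : ∀ (xs : List A) n f → ∑[ a ∈ xs ] (n · f a) ≈ n · ∑ xs f
    ∑-·ˡ [] n f = ≈-sym (·-zero n)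
    ∑-·ˡ (a ∷ xs) n f = ≈-trans (+-cong ≈-refl (∑-·ˡ xs n f)) (≈-sym (·-distrib-+ n _ _))

    ∑-zero : ∀ (xs : List A) → ∑[ a ∈ xs ] 0# ≈ 0#
    ∑-zero [] = ≈-refl
    ∑-zero (a ∷ xs) = ≈-trans (+-identityˡ _) (∑-zero xs)

    ∑-const : ∀ (xs : List A) k → ∑[ a ∈ xs ] k ≈ length xs · k
    ∑-const [] k = ≈-refl
    ∑-const (a ∷ xs) k = +-cong ≈-refl (∑-const xs k)

    ∑-toℕ : ∀ (P : A → Bool) xs k → ∑[ a ∈ xs ] (toℕ (P a) · k) ≈ countᵇ P xs · k
    ∑-toℕ P [] k = ≈-refl
    ∑-toℕ P (a ∷ xs) k with P a
    ... | true  = +-cong (+-identityʳ k) (∑-toℕ P xs k)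
    ... | false = ≈-trans (+-identityˡ _) (∑-toℕ P xs k)

    ∑-if : ∀ (P : A → Bool) xs k f → ∑[ a ∈ xs ] ((if P a then k else 0#) * f a) ≈ k * ∑ (filterᵇ P xs) f
    ∑-if P [] k f = ≈-sym (zeroʳ k)
    ∑-if P (a ∷ xs) k f with P a
    ... | true  = ≈-trans (+-cong ≈-refl (∑-if P xs k f)) (≈-sym (distribˡ k _ _))
    ... | false = ≈-trans (+-cong (zeroˡ _) (∑-if P xs k f)) (+-identityˡ _)

    ∑-bits : ∀ {B : Set} (xs : List A) (g : A → Bool → B) f →
      ∑ (concatMap (λ a → map (g a) (false ∷ true ∷ [])) xs) f ≈ ∑[ a ∈ xs ] (f (g a false) + f (g a true))
    ∑-bits [] g f = ≈-refl
    ∑-bits (a ∷ xs) g f = ≈-trans (+-cong ≈-refl (+-cong ≈-refl (∑-bits xs g f))) (≈-sym (+-assoc _ _ _))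

  ∑-swap : ∀ {A B : Set} (xs : List A) (ys : List B) (f : A → B → Carrier) →
    ∑[ a ∈ xs ] ∑[ b ∈ ys ] f a b ≈ ∑[ b ∈ ys ] ∑[ a ∈ xs ] f a b
  ∑-swap [] ys f = ≈-sym (∑-zero ys)
  ∑-swap (a ∷ xs) ys f = ≈-trans (+-cong ≈-refl (∑-swap xs ys f)) (≈-sym (∑-+ ys (f a) _))

  ∑-delta : ∀ {m} (p : V m) (H : V m → Carrier) → ∑[ e ∈ allV m ] (toℕ (does (e ≟V p)) · H e) ≈ H p
  ∑-delta {m} p H = begin
    ∑[ e ∈ allV m ] (toℕ (does (e ≟V p)) · H e)  ≈⟨ ∑-cong (allV m) at-p ⟩
    ∑[ e ∈ allV m ] (toℕ (does (e ≟V p)) · H p)  ≈⟨ ∑-toℕ (λ e → does (e ≟V p)) (allV m) (H p) ⟩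
    count (λ e → does (e ≟V p)) · H p            ≈⟨ ·-congˡ (H p) (count-≟ p) ⟩
    1 · H p                                      ≈⟨ +-identityʳ (H p) ⟩
    H p                                          ∎
    where
    at-p : ∀ e → toℕ (does (e ≟V p)) · H e ≈ toℕ (does (e ≟V p)) · H p
    at-p e with e ≟V p
    ... | yes refl = ≈-refl
    ... | no _ = ≈-refl

  -- The summand of J at a codeword c: J C T w z x y unfolds to ∑ C (monomialOn (allV m) w z x y T).
  monomialOn : ∀ {m} → List (V m) → (w z x y : Carrier) → Word m → Word m → Carrier
  monomialOn vs w z x y T c =
    pow w (countᵇ (λ v → T v ∧ not (c v)) vs) * pow z (countᵇ (λ v → T v ∧ c v) vs)
    * pow x (countᵇ (λ v → not (T v) ∧ not (c v)) vs) * pow y (countᵇ (λ v → not (T v) ∧ c v) vs)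

  monomialOn-counts : ∀ {m} (w z x y : Carrier) (T c : Word m) {t k W₀ W₁ : ℕ} →
    count T ≡ t → count (λ v → T v ∧ c v) ≡ k → count (λ v → not (c v)) ≡ W₀ → count c ≡ W₁ →
    monomialOn (allV m) w z x y T c ≡ pow w (t ∸ k) * pow z k * pow x (W₀ ∸ (t ∸ k)) * pow y (W₁ ∸ k)
  monomialOn-counts {m} w z x y T c {t} {k} |T| |T∧c| |¬c| |c| =
    cong₂ _*_ (cong₂ _*_ (cong₂ _*_ (cong (pow w) |T∧¬c|) (cong (pow z) |T∧c|)) (cong (pow x) |¬T∧¬c|))
              (cong (pow y) |¬T∧c|)
    where
    vs = allV m
    difference : ∀ {a b n j} → a +ℕ b ≡ n → a ≡ j → b ≡ n ∸ j
    difference {a} {b} refl refl = sym (ℕ.m+n∸m≡n a b)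
    |T∧¬c| : count (λ v → T v ∧ not (c v)) ≡ t ∸ k
    |T∧¬c| = difference
      (trans (cong₂ _+ℕ_ (countᵇ-cong (λ v → Bool.∧-comm (T v) (c v)) vs)
                          (countᵇ-cong (λ v → Bool.∧-comm (T v) (not (c v))) vs))
             (trans (sym (countᵇ-split T c vs)) |T|))
      |T∧c|
    |¬T∧¬c| : count (λ v → not (T v) ∧ not (c v)) ≡ _
    |¬T∧¬c| = difference (trans (sym (countᵇ-split (λ v → not (c v)) T vs)) |¬c|) |T∧¬c|
    |¬T∧c| : count (λ v → not (T v) ∧ c v) ≡ _
    |¬T∧c| = difference (trans (sym (countᵇ-split c T vs)) |c|) |T∧c|

  collect-independent : ∀ n {J E₀ E₄ A₀ A₁ A₂ A₃ A₄} →
    J + (A₀ + A₄) ≈ (E₀ + E₄) + suc n · ((A₀ + A₄) + (4 · A₁ + 6 · A₂ + 4 · A₃)) →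
    J ≈ E₀ + n · A₀ + (4 *ℕ suc n) · A₁ + (6 *ℕ suc n) · A₂ + (4 *ℕ suc n) · A₃ + n · A₄ + E₄
  collect-independent n {J} {E₀} {E₄} {A₀} {A₁} {A₂} {A₃} {A₄} hyp =
    +-cancelʳ (A₀ + A₄) J _ (≈-trans hyp (≈-sym (begin
      E₀ + n · A₀ + B₁ + B₂ + B₃ + n · A₄ + E₄ + (A₀ + A₄)
        ≈⟨ rearrange E₀ E₄ A₀ A₄ (n · A₀) (n · A₄) B₁ B₂ B₃ ⟩
      (E₀ + E₄) + ((suc n · A₀ + suc n · A₄) + (B₁ + B₂ + B₃))
        ≈⟨ +-cong ≈-refl (+-cong (·-distrib-+ (suc n) A₀ A₄) (≈-sym scaled)) ⟨
      (E₀ + E₄) + (suc n · (A₀ + A₄) + suc n · (4 · A₁ + 6 · A₂ + 4 · A₃))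
        ≈⟨ +-cong ≈-refl (·-distrib-+ (suc n) _ _) ⟨
      (E₀ + E₄) + suc n · ((A₀ + A₄) + (4 · A₁ + 6 · A₂ + 4 · A₃)) ∎)))
    where
    B₁ = (4 *ℕ suc n) · A₁
    B₂ = (6 *ℕ suc n) · A₂
    B₃ = (4 *ℕ suc n) · A₃
    scaled : B₁ + B₂ + B₃ ≈ suc n · (4 · A₁ + 6 · A₂ + 4 · A₃)
    scaled = ≈-trans (+-cong (+-cong (·-*ℕ-comm 4 (suc n) A₁) (·-*ℕ-comm 6 (suc n) A₂)) (·-*ℕ-comm 4 (suc n) A₃))
                     (≈-sym (≈-trans (·-distrib-+ (suc n) _ _) (+-cong (·-distrib-+ (suc n) _ _) ≈-refl)))
    rearrange : ∀ e₀ e₄ a₀ a₄ n₀ n₄ b₁ b₂ b₃ →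
      e₀ + n₀ + b₁ + b₂ + b₃ + n₄ + e₄ + (a₀ + a₄) ≈ (e₀ + e₄) + ((a₀ + n₀) + (a₄ + n₄) + (b₁ + b₂ + b₃))
    rearrange = solve 9 (λ e₀ e₄ a₀ a₄ n₀ n₄ b₁ b₂ b₃ →
      ((((((e₀ ⊞ n₀) ⊞ b₁) ⊞ b₂) ⊞ b₃) ⊞ n₄) ⊞ e₄) ⊞ (a₀ ⊞ a₄)
        ⊜ (e₀ ⊞ e₄) ⊞ (((a₀ ⊞ n₀) ⊞ (a₄ ⊞ n₄)) ⊞ ((b₁ ⊞ b₂) ⊞ b₃))) ≈-refl

  collect-dependent : ∀ n {J E₀ E₄ A₀ A₂ A₄} →
    J + (A₀ + A₄) ≈ (E₀ + E₄) + suc n · ((A₀ + A₄) + 6 · A₂) →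
    J ≈ E₀ + n · A₀ + (6 *ℕ suc n) · A₂ + n · A₄ + E₄
  collect-dependent n {J} {E₀} {E₄} {A₀} {A₂} {A₄} hyp =
    +-cancelʳ (A₀ + A₄) J _ (≈-trans hyp (≈-sym (begin
      E₀ + n · A₀ + B₂ + n · A₄ + E₄ + (A₀ + A₄)
        ≈⟨ rearrange E₀ E₄ A₀ A₄ (n · A₀) (n · A₄) B₂ ⟩
      (E₀ + E₄) + ((suc n · A₀ + suc n · A₄) + B₂)
        ≈⟨ +-cong ≈-refl (+-cong (·-distrib-+ (suc n) A₀ A₄) (≈-sym (·-*ℕ-comm 6 (suc n) A₂))) ⟨
      (E₀ + E₄) + (suc n · (A₀ + A₄) + suc n · (6 · A₂))
        ≈⟨ +-cong ≈-refl (·-distrib-+ (suc n) _ _) ⟨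
      (E₀ + E₄) + suc n · ((A₀ + A₄) + 6 · A₂) ∎)))
    where
    B₂ = (6 *ℕ suc n) · A₂
    rearrange : ∀ e₀ e₄ a₀ a₄ n₀ n₄ b₂ →
      e₀ + n₀ + b₂ + n₄ + e₄ + (a₀ + a₄) ≈ (e₀ + e₄) + ((a₀ + n₀) + (a₄ + n₄) + b₂)
    rearrange = solve 7 (λ e₀ e₄ a₀ a₄ n₀ n₄ b₂ →
      ((((e₀ ⊞ n₀) ⊞ b₂) ⊞ n₄) ⊞ e₄) ⊞ (a₀ ⊞ a₄) ⊜ (e₀ ⊞ e₄) ⊞ (((a₀ ⊞ n₀) ⊞ (a₄ ⊞ n₄)) ⊞ b₂)) ≈-refl

-- Characters of F₂^m

module Characters {c ℓ : Level} (R : CommutativeRing c ℓ) where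

  open CommutativeRing R renaming (refl to ≈-refl; sym to ≈-sym; trans to ≈-trans)
  open RingSums R
  open import Relation.Binary.Reasoning.Setoid setoid
  import Algebra.Properties.Ring ring as RingProperties

  sign : Bool → Carrier
  sign false = 1#
  sign true = - 1#

  sign-xor : ∀ a b → sign (a xor b) ≈ sign a * sign b
  sign-xor false b = ≈-sym (*-identityˡ _)
  sign-xor true false = ≈-sym (*-identityʳ _)
  sign-xor true true = ≈-sym (≈-trans (RingProperties.-1*x≈-x (- 1#)) (RingProperties.-‿involutive 1#))

  ∑-sign : ∀ {A : Set} (xs : List A) (g : A → Bool) →
    ∑[ a ∈ xs ] sign (g a) ≈ countᵇ (λ a → not (g a)) xs · 1# + countᵇ g xs · (- 1#)
  ∑-sign [] g = ≈-sym (+-identityʳ _)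
  ∑-sign (a ∷ xs) g with g a
  ... | true  = ≈-trans (+-cong ≈-refl (∑-sign xs g)) (x∙yz≈y∙xz _ _ _)
    where open Algebra.Properties.CommutativeSemigroup +-commutativeSemigroup using (x∙yz≈y∙xz)
  ... | false = ≈-trans (+-cong ≈-refl (∑-sign xs g)) (≈-sym (+-assoc _ _ _))

  ∑-sign-dot : ∀ {m} (v : V m) → ∑[ a ∈ allV m ] sign (dot a v) ≈ toℕ (does (v ≟V 0V m)) · ((2 ^ℕ m) · 1#)
  ∑-sign-dot {m} v with v ≟V 0V m
  ... | yes refl = begin
    ∑[ a ∈ allV m ] sign (dot a (0V m))  ≈⟨ ∑-cong (allV m) (λ a → ≡⇒≈ (cong sign (dot-zeroʳ a))) ⟩
    ∑[ a ∈ allV m ] 1#                    ≈⟨ ∑-const (allV m) 1# ⟩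
    length (allV m) · 1#                  ≈⟨ ·-congˡ 1# (length-allV m) ⟩
    (2 ^ℕ m) · 1#                           ≈⟨ +-identityʳ _ ⟨
    1 · ((2 ^ℕ m) · 1#)                     ∎
  ... | no v≢0 = begin
    ∑[ a ∈ allV m ] sign (dot a v)
      ≈⟨ ∑-sign (allV m) (λ a → dot a v) ⟩
    count (λ a → not (dot a v)) · 1# + count (λ a → dot a v) · (- 1#)
      ≈⟨ +-cong (·-congˡ 1# (trans (countᵇ-cong zeros (allV m)) (count-affine v true v≢0)))
                (·-congˡ (- 1#) (trans (countᵇ-cong ones (allV m)) (count-affine v false v≢0))) ⟩
    h · 1# + h · (- 1#)
      ≈⟨ ·-distrib-+ h 1# (- 1#) ⟨
    h · (1# - 1#)
      ≈⟨ ·-congʳ h (-‿inverseʳ 1#) ⟩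
    h · 0#
      ≈⟨ ·-zero h ⟩
    0# ∎
    where
    h = 2 ^ℕ (m ∸ 1)
    ones : ∀ a → dot a v ≡ affine v false a
    ones a = trans (dot-comm a v) (sym (Bool.xor-identityʳ (dot v a)))
    zeros : ∀ a → not (dot a v) ≡ affine v true a
    zeros a = trans (cong not (ones a)) (Bool.not-distribʳ-xor (dot v a) false)

-- The MacWilliams identity for RM(1,m)

module MacWilliams {c ℓ : Level} (R : CommutativeRing c ℓ) where

  open CommutativeRing R renaming (refl to ≈-refl; sym to ≈-sym; trans to ≈-trans)
  open RingSums R
  open Characters R
  open import Relation.Binary.Reasoning.Setoid setoid
  import Algebra.Properties.Ring ring as RingProperties
  open import Algebra.Solver.CommutativeMonoid *-commutativeMonoid using (solve; _⊜_) renaming (_⊕_ to _⊗_)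
  import Data.List.Relation.Unary.All as All

  ∏ : ∀ {A : Set} → List A → (A → Carrier) → Carrier
  ∏ xs F = Data.List.foldr (λ a r → F a * r) 1# xs

  ∏-cong : ∀ {A : Set} {xs : List A} {F G : A → Carrier} → All (λ a → F a ≈ G a) xs → ∏ xs F ≈ ∏ xs G
  ∏-cong [] = ≈-refl
  ∏-cong (F≈G ∷ F≈Gs) = *-cong F≈G (∏-cong F≈Gs)

  ∏-cong-∀ : ∀ {A : Set} (xs : List A) {F G : A → Carrier} → (∀ a → F a ≈ G a) → ∏ xs F ≈ ∏ xs G
  ∏-cong-∀ xs F≈G = ∏-cong (All.universal F≈G xs)

  letter : (w z x y : Carrier) → Bool → Bool → Carrier
  letter w z x y t b = if t then (if b then z else w) else (if b then y else x)

  private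
    pull₁ : ∀ u A B C D → (u * A) * B * C * D ≈ u * (A * B * C * D)
    pull₁ = solve 5 (λ u A B C D → (((u ⊗ A) ⊗ B) ⊗ C) ⊗ D ⊜ u ⊗ (((A ⊗ B) ⊗ C) ⊗ D)) ≈-refl
    pull₂ : ∀ u A B C D → A * (u * B) * C * D ≈ u * (A * B * C * D)
    pull₂ = solve 5 (λ u A B C D → ((A ⊗ (u ⊗ B)) ⊗ C) ⊗ D ⊜ u ⊗ (((A ⊗ B) ⊗ C) ⊗ D)) ≈-refl
    pull₃ : ∀ u A B C D → A * B * (u * C) * D ≈ u * (A * B * C * D)
    pull₃ = solve 5 (λ u A B C D → ((A ⊗ B) ⊗ (u ⊗ C)) ⊗ D ⊜ u ⊗ (((A ⊗ B) ⊗ C) ⊗ D)) ≈-refl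
    pull₄ : ∀ u A B C D → A * B * C * (u * D) ≈ u * (A * B * C * D)
    pull₄ = solve 5 (λ u A B C D → ((A ⊗ B) ⊗ C) ⊗ (u ⊗ D) ⊜ u ⊗ (((A ⊗ B) ⊗ C) ⊗ D)) ≈-refl

  monomialOn-∏ : ∀ {m} (vs : List (V m)) w z x y T c →
    monomialOn vs w z x y T c ≈ ∏ vs (λ v → letter w z x y (T v) (c v))
  monomialOn-∏ [] w z x y T c = ≈-trans (*-identityʳ _) (≈-trans (*-identityʳ _) (*-identityʳ _))
  monomialOn-∏ (v ∷ vs) w z x y T c with T v | c v
  ... | true  | false = ≈-trans (pull₁ w _ _ _ _) (*-cong ≈-refl (monomialOn-∏ vs w z x y T c))
  ... | true  | true  = ≈-trans (pull₂ z _ _ _ _) (*-cong ≈-refl (monomialOn-∏ vs w z x y T c))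
  ... | false | false = ≈-trans (pull₃ x _ _ _ _) (*-cong ≈-refl (monomialOn-∏ vs w z x y T c))
  ... | false | true  = ≈-trans (pull₄ y _ _ _ _) (*-cong ≈-refl (monomialOn-∏ vs w z x y T c))

  ∏-+-expand : ∀ {m} (vs : List (V m)) → Unique vs → (A B : V m → Carrier) →
    ∏ vs (λ v → A v + B v) ≈ ∑[ d ∈ wordsOn vs ] ∏ vs (λ v → if d v then B v else A v)
  ∏-+-expand [] [] A B = ≈-sym (+-identityʳ _)
  ∏-+-expand {m} (p ∷ ps) (p∉ps ∷ unique) A B = ≈-sym (begin
    ∑[ d ∈ wordsOn (p ∷ ps) ] ∏ (p ∷ ps) (choose d)
      ≈⟨ ∑-bits (wordsOn ps) set-p (λ d → ∏ (p ∷ ps) (choose d)) ⟩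
    ∑[ f ∈ wordsOn ps ] (∏ (p ∷ ps) (choose (set-p f false)) + ∏ (p ∷ ps) (choose (set-p f true)))
      ≈⟨ ∑-cong (wordsOn ps) (λ f → +-cong (∏-set-p f false) (∏-set-p f true)) ⟩
    ∑[ f ∈ wordsOn ps ] (A p * ∏ ps (choose f) + B p * ∏ ps (choose f))
      ≈⟨ ∑-cong (wordsOn ps) (λ f → ≈-sym (distribʳ (∏ ps (choose f)) (A p) (B p))) ⟩
    ∑[ f ∈ wordsOn ps ] ((A p + B p) * ∏ ps (choose f))
      ≈⟨ ∑-*ˡ (wordsOn ps) (A p + B p) (λ f → ∏ ps (choose f)) ⟩
    (A p + B p) * ∑[ f ∈ wordsOn ps ] ∏ ps (choose f)
      ≈⟨ *-cong ≈-refl (∏-+-expand ps unique A B) ⟨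
    (A p + B p) * ∏ ps (λ v → A v + B v) ∎)
    where
    choose : Word m → V m → Carrier
    choose d v = if d v then B v else A v
    set-p : Word m → Bool → Word m
    set-p f b v = if does (v ≟V p) then b else f v
    unchanged : ∀ f b {v} → p ≢ v → choose (set-p f b) v ≈ choose f v
    unchanged f b {v} p≢v rewrite dec-false (v ≟V p) (λ v≡p → p≢v (sym v≡p)) = ≈-refl
    ∏-set-p : ∀ f b → ∏ (p ∷ ps) (choose (set-p f b)) ≈ (if b then B p else A p) * ∏ ps (choose f)
    ∏-set-p f b rewrite dec-true (p ≟V p) refl = *-cong ≈-refl (∏-cong (All.map (unchanged f b) p∉ps))

  ∏-sign : ∀ {m} (vs : List (V m)) (c d : Word m) (α β : V m → Carrier) →
    ∏ vs (λ v → if d v then sign (c v) * β v else α v)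
      ≈ sign (innerOn vs c d) * ∏ vs (λ v → if d v then β v else α v)
  ∏-sign [] c d α β = ≈-sym (*-identityʳ _)
  ∏-sign (v ∷ vs) c d α β with d v
  ... | true rewrite Bool.∧-identityʳ (c v) = begin
    sign (c v) * β v * ∏ vs _                         ≈⟨ *-cong ≈-refl (∏-sign vs c d α β) ⟩
    sign (c v) * β v * (sign (innerOn vs c d) * rest)  ≈⟨ interchange _ _ _ _ ⟩
    sign (c v) * sign (innerOn vs c d) * (β v * rest)  ≈⟨ *-cong (sign-xor (c v) _) ≈-refl ⟨
    sign (c v xor innerOn vs c d) * (β v * rest)       ∎
    where
    rest = ∏ vs (λ v → if d v then β v else α v)
    open Algebra.Properties.CommutativeSemigroup *-commutativeSemigroup using (interchange)
  ... | false rewrite Bool.∧-zeroʳ (c v) =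
    ≈-trans (*-cong ≈-refl (∏-sign vs c d α β)) (x∙yz≈y∙xz (α v) _ _)
    where open Algebra.Properties.CommutativeSemigroup *-commutativeSemigroup using (x∙yz≈y∙xz)

  ∑-sign-orthogonal : ∀ {m} (d : Word m) (cs : List (Word m)) →
    orthogonalTo cs d ≡ true → ∑[ c ∈ cs ] sign (inner c d) ≈ length cs · 1#
  ∑-sign-orthogonal d [] _ = ≈-refl
  ∑-sign-orthogonal {m} d (c ∷ cs) ⊥d with inner d c in d·c
  ... | false = +-cong (≡⇒≈ (cong sign (trans (innerOn-comm (allV m) c d) d·c))) (∑-sign-orthogonal d cs ⊥d)

  -- ⟨affine a b, d⟩ = a·S + b P with S the sum of the support of d and P its parity: the sum over b
  -- cancels unless P = 0, and then the sum over a cancels unless S = 0, i.e. unless d ∈ RM(1,m)^⊥.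
  ∑-sign-inner-RM1 : ∀ m (d : Word m) →
    ∑[ c ∈ RM1 m ] sign (inner c d) ≈ (if orthogonalTo (RM1 m) d then (2 ^ℕ (m +ℕ 1)) · 1# else 0#)
  ∑-sign-inner-RM1 m d with orthogonalTo (RM1 m) d in ⊥d
  ... | true = ≈-trans (∑-sign-orthogonal d (RM1 m) ⊥d) (·-congˡ 1# (length-RM1 m))
  ... | false = ≈-trans by-affine (vanishing P refl (S ≟V 0V m))
    where
    S = pointSumOn (allV m) d
    P = parityOn (allV m) d
    by-affine : ∑[ c ∈ RM1 m ] sign (inner c d)
                  ≈ ∑[ a ∈ allV m ] (sign (dot a S xor false) + sign (dot a S xor P))
    by-affine = ≈-trans (∑-bits (allV m) affine (λ c → sign (inner c d)))
      (∑-cong (allV m) (λ a → +-cong (≡⇒≈ (cong sign (inner-affine a false d)))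
                                     (≡⇒≈ (cong sign (inner-affine a true d)))))
    cancel : ∀ s → sign (s xor false) + sign (s xor true) ≈ 0#
    cancel false = -‿inverseʳ 1#
    cancel true = -‿inverseˡ 1#
    vanishing : ∀ p → P ≡ p → Dec (S ≡ 0V m) →
      ∑[ a ∈ allV m ] (sign (dot a S xor false) + sign (dot a S xor p)) ≈ 0#
    vanishing true _ _ = ≈-trans (∑-cong (allV m) (λ a → cancel (dot a S))) (∑-zero (allV m))
    vanishing false P≡false (yes S≡0) with () ← trans (sym (orthogonal-RM1 d S≡0 P≡false)) ⊥d
    vanishing false _ (no S≢0) = begin
      ∑[ a ∈ allV m ] (sign (dot a S xor false) + sign (dot a S xor false))
        ≈⟨ ∑-+ (allV m) _ _ ⟩
      ∑[ a ∈ allV m ] sign (dot a S xor false) + ∑[ a ∈ allV m ] sign (dot a S xor false)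
        ≈⟨ +-cong half half ⟩
      0# + 0#
        ≈⟨ +-identityʳ 0# ⟩
      0# ∎
      where
      half : ∑[ a ∈ allV m ] sign (dot a S xor false) ≈ 0#
      half = ≈-trans (∑-cong (allV m) (λ a → ≡⇒≈ (cong sign (Bool.xor-identityʳ (dot a S)))))
                     (≈-trans (∑-sign-dot S) (≡⇒≈ (cong (λ b → toℕ b · _) (dec-false (S ≟V 0V m) S≢0))))

  macWilliams-RM1 : ∀ m (T : Word m) (w z x y : Carrier) →
    (2 ^ℕ (m +ℕ 1)) · J (dual (RM1 m)) T w z x y ≈ J (RM1 m) T (w + z) (w - z) (x + y) (x - y)
  macWilliams-RM1 m T w z x y = ≈-sym (begin
    J C T (w + z) (w - z) (x + y) (x - y)
      ≈⟨ ∑-cong C (monomialOn-∏ vs (w + z) (w - z) (x + y) (x - y) T) ⟩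
    ∑[ c ∈ C ] ∏ vs (λ v → letter (w + z) (w - z) (x + y) (x - y) (T v) (c v))
      ≈⟨ ∑-cong C (λ c → ∏-cong-∀ vs (λ v → letter-± (T v) (c v))) ⟩
    ∑[ c ∈ C ] ∏ vs (λ v → α v + sign (c v) * β v)
      ≈⟨ ∑-cong C (λ c → ∏-+-expand vs (unique-allV m) α (λ v → sign (c v) * β v)) ⟩
    ∑[ c ∈ C ] ∑[ d ∈ W ] ∏ vs (λ v → if d v then sign (c v) * β v else α v)
      ≈⟨ ∑-cong C (λ c → ∑-cong W (λ d → ∏-sign vs c d α β)) ⟩
    ∑[ c ∈ C ] ∑[ d ∈ W ] (sign (inner c d) * M d)
      ≈⟨ ∑-swap C W (λ c d → sign (inner c d) * M d) ⟩
    ∑[ d ∈ W ] ∑[ c ∈ C ] (sign (inner c d) * M d)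
      ≈⟨ ∑-cong W (λ d → ∑-*ʳ C (M d) (λ c → sign (inner c d))) ⟩
    ∑[ d ∈ W ] (∑[ c ∈ C ] sign (inner c d) * M d)
      ≈⟨ ∑-cong W (λ d → *-cong (∑-sign-inner-RM1 m d) ≈-refl) ⟩
    ∑[ d ∈ W ] ((if orthogonalTo C d then K else 0#) * M d)
      ≈⟨ ∑-if (orthogonalTo C) W K M ⟩
    K * ∑ (dual C) M
      ≈⟨ *-cong ≈-refl (∑-cong (dual C) (λ d → ≈-sym (≈-trans (monomialOn-∏ vs w z x y T d)
                                                       (∏-cong-∀ vs (λ v → letter-select (T v) (d v)))))) ⟩
    K * J (dual C) T w z x y
      ≈⟨ ·≈·1#* (2 ^ℕ (m +ℕ 1)) _ ⟨
    (2 ^ℕ (m +ℕ 1)) · J (dual C) T w z x y ∎)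
    where
    C = RM1 m
    W = allWords m
    vs = allV m
    K = (2 ^ℕ (m +ℕ 1)) · 1#
    α β : V m → Carrier
    α v = if T v then w else x
    β v = if T v then z else y
    M : Word m → Carrier
    M d = ∏ vs (λ v → if d v then β v else α v)
    letter-± : ∀ t b →
      letter (w + z) (w - z) (x + y) (x - y) t b ≈ (if t then w else x) + sign b * (if t then z else y)
    letter-± true  false = +-cong ≈-refl (≈-sym (*-identityˡ z))
    letter-± true  true  = +-cong ≈-refl (≈-sym (RingProperties.-1*x≈-x z))
    letter-± false false = +-cong ≈-refl (≈-sym (*-identityˡ y))
    letter-± false true  = +-cong ≈-refl (≈-sym (RingProperties.-1*x≈-x y))
    letter-select : ∀ t b → letter w z x y t b ≈ (if b then (if t then z else y) else (if t then w else x))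
    letter-select true  true  = ≈-refl
    letter-select true  false = ≈-refl
    letter-select false true  = ≈-refl
    letter-select false false = ≈-refl

-- Fibres of a ↦ (a·u₁, …, a·uₖ)

fibre : ∀ {m k} → (V m → V k) → V k → List (V m) → ℕ
fibre f e = countᵇ (λ a → does (e ≟V f a))

module FibreSize {c ℓ : Level} (R : CommutativeRing c ℓ) where

  open CommutativeRing R renaming (refl to ≈-refl; sym to ≈-sym; trans to ≈-trans)
  open RingSums R
  open Characters R
  open import Relation.Binary.Reasoning.Setoid setoid

  does-⊕-≟V-0 : ∀ {k} (e x : V k) → does ((e ⊕ x) ≟V 0V k) ≡ does (e ≟V x)
  does-⊕-≟V-0 e x with e ≟V x
  ... | yes refl = dec-true ((e ⊕ e) ≟V _) (⊕-same e)
  ... | no e≢x = dec-false ((e ⊕ x) ≟V _) (λ e⊕x≡0 → e≢x (⊕≡0⇒≡ e⊕x≡0))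

  indicator-expansion : ∀ {k} (e x : V k) →
    toℕ (does (e ≟V x)) · ((2 ^ℕ k) · 1#) ≈ ∑[ σ ∈ allV k ] (sign (dot σ e) * sign (dot σ x))
  indicator-expansion {k} e x = begin
    toℕ (does (e ≟V x)) · ((2 ^ℕ k) · 1#)            ≡⟨ cong (λ b → toℕ b · _) (does-⊕-≟V-0 e x) ⟨
    toℕ (does ((e ⊕ x) ≟V 0V k)) · ((2 ^ℕ k) · 1#)   ≈⟨ ∑-sign-dot (e ⊕ x) ⟨
    ∑[ σ ∈ allV k ] sign (dot σ (e ⊕ x))             ≈⟨ ∑-cong (allV k) expand ⟩
    ∑[ σ ∈ allV k ] (sign (dot σ e) * sign (dot σ x)) ∎
    where
    expand : ∀ σ → sign (dot σ (e ⊕ x)) ≈ sign (dot σ e) * sign (dot σ x)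
    expand σ = ≈-trans (≡⇒≈ (cong sign (dot-distribʳ-⊕ σ e x))) (sign-xor (dot σ e) (dot σ x))

  -- 2^k [x = e] = ∑_σ (-1)^{σ·e} (-1)^{σ·x}, and ∑_a (-1)^{σ·(dots a us)} = ∑_a (-1)^{a·∑ σᵢuᵢ}
  -- vanishes unless ∑ σᵢuᵢ = 0, that is, by independence, unless σ = 0.
  fibre-size : ∀ {m k} (us : Vec (V m) k) → Independent us → ∀ e →
    (2 ^ℕ k *ℕ fibre (λ a → dots a us) e (allV m)) · 1# ≈ (2 ^ℕ m) · 1#
  fibre-size {m} {k} us independent e = begin
    (2 ^ℕ k *ℕ fibre x e (allV m)) · 1#
      ≈⟨ ·-assoc (2 ^ℕ k) _ 1# ⟩
    (2 ^ℕ k) · (fibre x e (allV m) · 1#)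
      ≈⟨ ·-congʳ (2 ^ℕ k) (∑-toℕ (λ a → does (e ≟V x a)) (allV m) 1#) ⟨
    (2 ^ℕ k) · (∑[ a ∈ allV m ] (toℕ (does (e ≟V x a)) · 1#))
      ≈⟨ ∑-·ˡ (allV m) (2 ^ℕ k) _ ⟨
    ∑[ a ∈ allV m ] ((2 ^ℕ k) · (toℕ (does (e ≟V x a)) · 1#))
      ≈⟨ ∑-cong (allV m) (λ a → swap-scalars (toℕ (does (e ≟V x a)))) ⟩
    ∑[ a ∈ allV m ] (toℕ (does (e ≟V x a)) · ((2 ^ℕ k) · 1#))
      ≈⟨ ∑-cong (allV m) (λ a → indicator-expansion e (x a)) ⟩
    ∑[ a ∈ allV m ] ∑[ σ ∈ allV k ] (sign (dot σ e) * sign (dot σ (x a)))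
      ≈⟨ ∑-swap (allV m) (allV k) _ ⟩
    ∑[ σ ∈ allV k ] ∑[ a ∈ allV m ] (sign (dot σ e) * sign (dot σ (x a)))
      ≈⟨ ∑-cong (allV k) (λ σ → ∑-*ˡ (allV m) (sign (dot σ e)) _) ⟩
    ∑[ σ ∈ allV k ] (sign (dot σ e) * (∑[ a ∈ allV m ] sign (dot σ (x a))))
      ≈⟨ ∑-cong (allV k) (λ σ → *-cong ≈-refl (∑-cong (allV m) (λ a → ≡⇒≈ (cong sign (dot-combination a σ us))))) ⟨
    ∑[ σ ∈ allV k ] (sign (dot σ e) * (∑[ a ∈ allV m ] sign (dot a (combination σ us))))
      ≈⟨ ∑-cong (allV k) (λ σ → *-cong ≈-refl (∑-sign-dot (combination σ us))) ⟩
    ∑[ σ ∈ allV k ] (sign (dot σ e) * (toℕ (does (combination σ us ≟V 0V m)) · ((2 ^ℕ m) · 1#)))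
      ≈⟨ ∑-cong (allV k) only-σ≡0 ⟩
    ∑[ σ ∈ allV k ] (toℕ (does (σ ≟V 0V k)) · ((2 ^ℕ m) · 1#))
      ≈⟨ ∑-delta (0V k) (λ _ → (2 ^ℕ m) · 1#) ⟩
    (2 ^ℕ m) · 1# ∎
    where
    x : V m → V k
    x a = dots a us
    swap-scalars : ∀ i → (2 ^ℕ k) · (i · 1#) ≈ i · ((2 ^ℕ k) · 1#)
    swap-scalars i = ≈-trans (≈-sym (·-assoc (2 ^ℕ k) i 1#)) (·-*ℕ-comm (2 ^ℕ k) i 1#)
    only-σ≡0 : ∀ σ → sign (dot σ e) * (toℕ (does (combination σ us ≟V 0V m)) · ((2 ^ℕ m) · 1#))
                      ≈ toℕ (does (σ ≟V 0V k)) · ((2 ^ℕ m) · 1#)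
    only-σ≡0 σ with σ ≟V 0V k
    ... | yes refl rewrite combination-zero us | dec-true (0V m ≟V 0V m) refl | dot-zeroˡ e =
      *-identityˡ _
    ... | no σ≢0 rewrite dec-false (combination σ us ≟V 0V m) (λ c≡0 → σ≢0 (independent σ c≡0)) =
      zeroʳ _

fibre-count : ∀ {m k} (us : Vec (V m) k) → Independent us → ∀ e →
  2 ^ℕ k *ℕ fibre (λ a → dots a us) e (allV m) ≡ 2 ^ℕ m
fibre-count us independent e =
  ℤ.+-injective (trans (sym (·1≡+ _))
                (trans (FibreSize.fibre-size ℤ.+-*-commutativeRing us independent e) (·1≡+ _)))
  where
  open Jacobi ℤ.+-*-commutativeRing using (_·_)
  ·1≡+ : ∀ n → n · (ℤ.+ 1) ≡ ℤ.+ n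
  ·1≡+ zero = refl
  ·1≡+ (suc n) = cong (ℤ._+_ (ℤ.+ 1)) (·1≡+ n)

independent⇒≤ : ∀ {m k} (us : Vec (V m) k) → Independent us → k ≤ m
independent⇒≤ {m} {k} us independent = proj₁ (2^k*c≡2^m⇒ k m _ (fibre-count us independent (0V k)))

module FibreSums {c ℓ : Level} (R : CommutativeRing c ℓ) where

  open CommutativeRing R renaming (refl to ≈-refl; sym to ≈-sym; trans to ≈-trans)
  open RingSums R
  open import Relation.Binary.Reasoning.Setoid setoid

  ∑-fibres : ∀ {m k} (f : V m → V k) (H : V k → Carrier) (as : List (V m)) →
    ∑[ a ∈ as ] H (f a) ≈ ∑[ e ∈ allV k ] (fibre f e as · H e)
  ∑-fibres {k = k} f H [] = ≈-sym (∑-zero (allV k))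
  ∑-fibres {k = k} f H (a ∷ as) = begin
    H (f a) + ∑[ a ∈ as ] H (f a)
      ≈⟨ +-cong (∑-delta (f a) H) (≈-sym (∑-fibres f H as)) ⟨
    ∑[ e ∈ allV k ] (toℕ (does (e ≟V f a)) · H e) + ∑[ e ∈ allV k ] (fibre f e as · H e)
      ≈⟨ ∑-+ (allV k) _ _ ⟨
    ∑[ e ∈ allV k ] (toℕ (does (e ≟V f a)) · H e + fibre f e as · H e)
      ≈⟨ ∑-cong (allV k) (λ e → ≈-sym (·-homo-+ (toℕ (does (e ≟V f a))) (fibre f e as) (H e))) ⟩
    ∑[ e ∈ allV k ] ((toℕ (does (e ≟V f a)) +ℕ fibre f e as) · H e)
      ≈⟨ ∑-cong (allV k) (λ e → ·-congˡ (H e) (sym (countᵇ-∷ (λ a → does (e ≟V f a)) a as))) ⟩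
    ∑[ e ∈ allV k ] (fibre f e (a ∷ as) · H e) ∎

  ∑-dots : ∀ {m k} (us : Vec (V m) k) → Independent us → (H : V k → Carrier) →
    ∑[ a ∈ allV m ] H (dots a us) ≈ (2 ^ℕ (m ∸ k)) · (∑[ e ∈ allV k ] H e)
  ∑-dots {m} {k} us independent H = begin
    ∑[ a ∈ allV m ] H (dots a us)
      ≈⟨ ∑-fibres (λ a → dots a us) H (allV m) ⟩
    ∑[ e ∈ allV k ] (fibre (λ a → dots a us) e (allV m) · H e)
      ≈⟨ ∑-cong (allV k) (λ e → ·-congˡ (H e) (proj₂ (2^k*c≡2^m⇒ k m _ (fibre-count us independent e)))) ⟩
    ∑[ e ∈ allV k ] ((2 ^ℕ (m ∸ k)) · H e)
      ≈⟨ ∑-·ˡ (allV k) (2 ^ℕ (m ∸ k)) H ⟩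
    (2 ^ℕ (m ∸ k)) · (∑[ e ∈ allV k ] H e) ∎

-- The codewords of RM(1,m) seen from T = {0, u₁, u₂, u₃}

count-point : ∀ {m} (p : V m) (Q : V m → Bool) → count (λ v → does (v ≟V p) ∧ Q v) ≡ toℕ (Q p)
count-point {m} p Q = trans (countᵇ-cong at-p (allV m)) (by-value (Q p))
  where
  at-p : ∀ v → does (v ≟V p) ∧ Q v ≡ does (v ≟V p) ∧ Q p
  at-p v with v ≟V p
  ... | yes refl = refl
  ... | no _ = refl
  by-value : ∀ b → count (λ v → does (v ≟V p) ∧ b) ≡ toℕ b
  by-value true = trans (countᵇ-cong (λ v → Bool.∧-identityʳ _) (allV m)) (count-≟ p)
  by-value false = trans (countᵇ-cong (λ v → Bool.∧-zeroʳ _) (allV m)) (countᵇ-false (allV m))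

-- The number of ones of affine a b on 0, u₁, u₂, u₃, where e = (a·u₁, a·u₂, a·u₃).
onesOnT : V 3 → Bool → ℕ
onesOnT (e₁ ∷ e₂ ∷ e₃ ∷ []) b = toℕ b +ℕ (toℕ (e₁ xor b) +ℕ (toℕ (e₂ xor b) +ℕ toℕ (e₃ xor b)))

module FourPoints {m} (u₁ u₂ u₃ : V m)
  (0≢u₁ : 0V m ≢ u₁) (0≢u₂ : 0V m ≢ u₂) (0≢u₃ : 0V m ≢ u₃)
  (u₁≢u₂ : u₁ ≢ u₂) (u₁≢u₃ : u₁ ≢ u₃) (u₂≢u₃ : u₂ ≢ u₃) where

  T : Word m
  T = setT u₁ u₂ u₃

  count-T∧ : ∀ Q → count (λ v → T v ∧ Q v) ≡ toℕ (Q (0V m)) +ℕ (toℕ (Q u₁) +ℕ (toℕ (Q u₂) +ℕ toℕ (Q u₃)))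
  count-T∧ Q =
    trans (countᵇ-∨ (is (0V m)) (λ v → is u₁ v ∨ (is u₂ v ∨ is u₃ v)) Q disjoint₀ (allV m))
    (cong₂ _+ℕ_ (count-point (0V m) Q)
    (trans (countᵇ-∨ (is u₁) (λ v → is u₂ v ∨ is u₃ v) Q disjoint₁ (allV m))
    (cong₂ _+ℕ_ (count-point u₁ Q)
    (trans (countᵇ-∨ (is u₂) (is u₃) Q disjoint₂ (allV m))
    (cong₂ _+ℕ_ (count-point u₂ Q) (count-point u₃ Q))))))
    where
    is : V m → V m → Bool
    is p v = does (v ≟V p)
    excludes : ∀ {p q} → p ≢ q → ∀ v → is p v ≡ true → is q v ≡ false
    excludes {p} {q} p≢q v v=p with v ≟V p
    ... | yes refl = dec-false (p ≟V q) p≢q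
    disjoint₀ : ∀ v → is (0V m) v ≡ true → (is u₁ v ∨ (is u₂ v ∨ is u₃ v)) ≡ false
    disjoint₀ v v=0 rewrite excludes 0≢u₁ v v=0 | excludes 0≢u₂ v v=0 | excludes 0≢u₃ v v=0 = refl
    disjoint₁ : ∀ v → is u₁ v ≡ true → (is u₂ v ∨ is u₃ v) ≡ false
    disjoint₁ v v=u₁ rewrite excludes u₁≢u₂ v v=u₁ | excludes u₁≢u₃ v v=u₁ = refl
    disjoint₂ : ∀ v → is u₂ v ≡ true → is u₃ v ≡ false
    disjoint₂ = excludes u₂≢u₃

  U : Vec (V m) 3
  U = u₁ ∷ u₂ ∷ u₃ ∷ []

  count-T : count T ≡ 4
  count-T = trans (countᵇ-cong (λ v → sym (Bool.∧-identityʳ (T v))) (allV m)) (count-T∧ (λ _ → true))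

  count-T∧affine : ∀ a b → count (λ v → T v ∧ affine a b v) ≡ onesOnT (dots a U) b
  count-T∧affine a b = trans (count-T∧ (affine a b)) (cong (λ d → toℕ (d xor b) +ℕ onesOnU) (dot-zeroʳ a))
    where onesOnU = toℕ (affine a b u₁) +ℕ (toℕ (affine a b u₂) +ℕ toℕ (affine a b u₃))

  count-not-affine : ∀ (a : V m) b → count (λ v → not (affine a b v)) ≡ count (affine a (not b))
  count-not-affine a b = countᵇ-cong (λ v → Bool.not-distribʳ-xor (dot a v) b) (allV m)

  count-affine-zero : ∀ b → count (affine (0V m) b) ≡ count {m} (λ _ → b)
  count-affine-zero b = countᵇ-cong (λ v → cong (_xor b) (dot-zeroˡ v)) (allV m)

  count-T∧affine-zero : ∀ b → count (λ v → T v ∧ affine (0V m) b v) ≡ toℕ b +ℕ (toℕ b +ℕ (toℕ b +ℕ toℕ b))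
  count-T∧affine-zero b = trans (countᵇ-cong (λ v → cong (λ d → T v ∧ (d xor b)) (dot-zeroˡ v)) (allV m))
                                (count-T∧ (λ _ → b))

  independent-U : u₁ ⊕ u₂ ≢ u₃ → Independent U
  independent-U u₁⊕u₂≢u₃ = independent-∷ (independent-∷ (independent-∷ independent-[] u₃∉) u₂∉) u₁∉
    where
    u₃∉ : ∀ σ → u₃ ≢ combination σ []
    u₃∉ [] u₃≡0 = 0≢u₃ (sym u₃≡0)
    u₂∉ : ∀ σ → u₂ ≢ combination σ (u₃ ∷ [])
    u₂∉ (false ∷ []) u₂≡0 = 0≢u₂ (sym u₂≡0)
    u₂∉ (true ∷ []) u₂≡u₃⊕0 = u₂≢u₃ (trans u₂≡u₃⊕0 (⊕-identityʳ u₃))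
    u₁∉ : ∀ σ → u₁ ≢ combination σ (u₂ ∷ u₃ ∷ [])
    u₁∉ (false ∷ false ∷ []) u₁≡0 = 0≢u₁ (sym u₁≡0)
    u₁∉ (true ∷ false ∷ []) u₁≡u₂⊕0 = u₁≢u₂ (trans u₁≡u₂⊕0 (⊕-identityʳ u₂))
    u₁∉ (false ∷ true ∷ []) u₁≡u₃⊕0 = u₁≢u₃ (trans u₁≡u₃⊕0 (⊕-identityʳ u₃))
    u₁∉ (true ∷ true ∷ []) u₁≡u₂⊕u₃⊕0 = u₁⊕u₂≢u₃ (begin
      u₁ ⊕ u₂         ≡⟨ cong (_⊕ u₂) (trans u₁≡u₂⊕u₃⊕0 (cong (u₂ ⊕_) (⊕-identityʳ u₃))) ⟩
      (u₂ ⊕ u₃) ⊕ u₂  ≡⟨ ⊕-cancelˡ u₂ u₃ ⟩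
      u₃              ∎)
      where open ≡-Reasoning

  independent-u₁u₂ : Independent (u₁ ∷ u₂ ∷ [])
  independent-u₁u₂ = independent-∷ (independent-∷ independent-[] u₂∉) u₁∉
    where
    u₂∉ : ∀ σ → u₂ ≢ combination σ []
    u₂∉ [] u₂≡0 = 0≢u₂ (sym u₂≡0)
    u₁∉ : ∀ σ → u₁ ≢ combination σ (u₂ ∷ [])
    u₁∉ (false ∷ []) u₁≡0 = 0≢u₁ (sym u₁≡0)
    u₁∉ (true ∷ []) u₁≡u₂⊕0 = u₁≢u₂ (trans u₁≡u₂⊕0 (⊕-identityʳ u₂))

  appendSum : V 2 → V 3
  appendSum (e₁ ∷ e₂ ∷ []) = e₁ ∷ e₂ ∷ (e₁ xor e₂) ∷ []

  dots-U-dependent : u₁ ⊕ u₂ ≡ u₃ → ∀ a → dots a U ≡ appendSum (dots a (u₁ ∷ u₂ ∷ []))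
  dots-U-dependent u₁⊕u₂≡u₃ a =
    cong (λ d → dot a u₁ ∷ dot a u₂ ∷ d ∷ []) (trans (cong (dot a) (sym u₁⊕u₂≡u₃)) (dot-distribʳ-⊕ a u₁ u₂))

  module Monomials {c ℓ : Level} (R : CommutativeRing c ℓ) (w z x y : CommutativeRing.Carrier R) where

    open CommutativeRing R renaming (refl to ≈-refl; sym to ≈-sym; trans to ≈-trans)
    open RingSums R
    open FibreSums R
    open import Algebra.Solver.CommutativeMonoid +-commutativeMonoid
      using (solve; _⊜_; Expr; id) renaming (_⊕_ to _⊞_)
    open import Relation.Binary.Reasoning.Setoid setoid

    h N : ℕ
    h = 2 ^ℕ (m ∸ 1)
    N = 2 ^ℕ m

    term : ℕ → Carrier
    term j = pow w (4 ∸ j) * pow z j * pow x (h ∸ (4 ∸ j)) * pow y (h ∸ j)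

    monomial : Word m → Carrier
    monomial = monomialOn (allV m) w z x y T

    monomial-affine : ∀ a b → a ≢ 0V m → monomial (affine a b) ≡ term (onesOnT (dots a U) b)
    monomial-affine a b a≢0 = monomialOn-counts w z x y T (affine a b) count-T (count-T∧affine a b)
      (trans (count-not-affine a b) (count-affine a (not b) a≢0)) (count-affine a b a≢0)

    E₀ E₄ : Carrier
    E₀ = pow w 4 * pow z 0 * pow x (N ∸ 4) * pow y 0
    E₄ = pow w 0 * pow z 4 * pow x 0 * pow y (N ∸ 4)

    monomial-zero : monomial (affine (0V m) false) ≡ E₀
    monomial-zero = monomialOn-counts w z x y T (affine (0V m) false) count-T
      (count-T∧affine-zero false) count-all (trans (count-affine-zero false) (countᵇ-false (allV m)))
      where
      count-all = trans (count-not-affine (0V m) false)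
                        (trans (count-affine-zero true) (trans (countᵇ-true (allV m)) (length-allV m)))

    monomial-one : monomial (affine (0V m) true) ≡ E₄
    monomial-one = monomialOn-counts w z x y T (affine (0V m) true) count-T
      (count-T∧affine-zero true) count-none count-all
      where
      count-none = trans (count-not-affine (0V m) true) (trans (count-affine-zero false) (countᵇ-false (allV m)))
      count-all = trans (count-affine-zero true) (trans (countᵇ-true (allV m)) (length-allV m))

    termPair : V 3 → Carrier
    termPair e = term (onesOnT e false) + term (onesOnT e true)

    -- a = 0 gives the constant words E₀, E₄ and every other a gives termPair (dots a U);
    -- adding the missing a = 0 term termPair (dots 0 U) to both sides lets the sum run over all a.
    J-RM1-split : J (RM1 m) T w z x y + termPair (0V 3) ≈ (E₀ + E₄) + ∑[ a ∈ allV m ] termPair (dots a U)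
    J-RM1-split = begin
      J (RM1 m) T w z x y + termPair (0V 3)
        ≈⟨ +-cong (≈-sym (∑-bits (allV m) affine monomial)) (∑-delta (0V m) (λ _ → termPair (0V 3))) ⟨
      ∑[ a ∈ allV m ] F a + ∑[ a ∈ allV m ] (δ a · termPair (0V 3))
        ≈⟨ ∑-+ (allV m) _ _ ⟨
      ∑[ a ∈ allV m ] (F a + δ a · termPair (0V 3))
        ≈⟨ ∑-cong (allV m) split-off-0 ⟩
      ∑[ a ∈ allV m ] (termPair (dots a U) + δ a · (E₀ + E₄))
        ≈⟨ ∑-+ (allV m) _ _ ⟩
      ∑[ a ∈ allV m ] termPair (dots a U) + ∑[ a ∈ allV m ] (δ a · (E₀ + E₄))
        ≈⟨ +-cong ≈-refl (∑-delta (0V m) (λ _ → E₀ + E₄)) ⟩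
      ∑[ a ∈ allV m ] termPair (dots a U) + (E₀ + E₄)
        ≈⟨ +-comm _ _ ⟩
      (E₀ + E₄) + ∑[ a ∈ allV m ] termPair (dots a U) ∎
      where
      F : V m → Carrier
      F a = monomial (affine a false) + monomial (affine a true)
      δ : V m → ℕ
      δ a = toℕ (does (a ≟V 0V m))
      split-off-0 : ∀ a → F a + toℕ (does (a ≟V 0V m)) · termPair (0V 3)
                           ≈ termPair (dots a U) + toℕ (does (a ≟V 0V m)) · (E₀ + E₄)
      split-off-0 a with a ≟V 0V m
      ... | yes refl = ≈-trans (+-comm (F (0V m)) _)
            (+-cong (≈-trans (+-identityʳ _) (≡⇒≈ (cong termPair (sym (dots-zero U)))))
                    (≈-trans (≡⇒≈ (cong₂ _+_ monomial-zero monomial-one)) (≈-sym (+-identityʳ _))))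
      ... | no a≢0 = +-cong (≡⇒≈ (cong₂ _+_ (monomial-affine a false a≢0) (monomial-affine a true a≢0))) ≈-refl

    private
      _×ₑ_ : ∀ {n} → ℕ → Expr n → Expr n
      zero ×ₑ e = id
      suc k ×ₑ e = e ⊞ (k ×ₑ e)

    ∑-termPair : ∑[ e ∈ allV 3 ] termPair e ≈ (term 0 + term 4) + (4 · term 1 + 6 · term 2 + 4 · term 3)
    ∑-termPair = solve 5 (λ t₀ t₁ t₂ t₃ t₄ →
      (t₀ ⊞ t₄) ⊞ (t₁ ⊞ t₃) ⊞ (t₁ ⊞ t₃) ⊞ (t₂ ⊞ t₂) ⊞ (t₁ ⊞ t₃) ⊞ (t₂ ⊞ t₂) ⊞ (t₂ ⊞ t₂) ⊞ (t₃ ⊞ t₁) ⊞ id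
        ⊜ (t₀ ⊞ t₄) ⊞ (((4 ×ₑ t₁) ⊞ (6 ×ₑ t₂)) ⊞ (4 ×ₑ t₃))) ≈-refl (term 0) (term 1) (term 2) (term 3) (term 4)

    ∑-termPair-appendSum : ∑[ e ∈ allV 2 ] termPair (appendSum e) ≈ (term 0 + term 4) + 6 · term 2
    ∑-termPair-appendSum = solve 3 (λ t₀ t₂ t₄ →
      (t₀ ⊞ t₄) ⊞ (t₂ ⊞ t₂) ⊞ (t₂ ⊞ t₂) ⊞ (t₂ ⊞ t₂) ⊞ id
        ⊜ (t₀ ⊞ t₄) ⊞ (6 ×ₑ t₂)) ≈-refl (term 0) (term 2) (term 4)

    E₀-shape : E₀ ≈ pow w 4 * pow x (N ∸ 4)
    E₀-shape = ≈-trans (*-identityʳ _) (*-cong (*-identityʳ _) ≈-refl)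

    E₄-shape : E₄ ≈ pow z 4 * pow y (N ∸ 4)
    E₄-shape = *-cong (≈-trans (*-identityʳ _) (*-identityˡ _)) ≈-refl

    term0-shape : term 0 ≈ pow w 4 * pow x (h ∸ 4) * pow y h
    term0-shape = *-cong (*-cong (*-identityʳ _) ≈-refl) ≈-refl

    term1-shape : term 1 ≈ pow w 3 * z * pow x (h ∸ 3) * pow y (h ∸ 1)
    term1-shape = *-cong (*-cong (*-cong ≈-refl (*-identityʳ z)) ≈-refl) ≈-refl

    term3-shape : term 3 ≈ w * pow z 3 * pow x (h ∸ 1) * pow y (h ∸ 3)
    term3-shape = *-cong (*-cong (*-cong (*-identityʳ w) ≈-refl) ≈-refl) ≈-refl

    term4-shape : term 4 ≈ pow z 4 * pow x h * pow y (h ∸ 4)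
    term4-shape = *-cong (*-cong (*-identityˡ _) ≈-refl) ≈-refl

    private
      ·-cong : ∀ {i j a b} → i ≡ j → a ≈ b → i · a ≈ j · b
      ·-cong {j = j} refl a≈b = ·-congʳ j a≈b

    J-RM1-independent : u₁ ⊕ u₂ ≢ u₃ →
      J (RM1 m) T w z x y ≈
        pow w 4 * pow x (N ∸ 4)
        + ((2 ^ℕ (m ∸ 3) ∸ 1) · (pow w 4 * pow x (h ∸ 4) * pow y h))
        + (h · (pow w 3 * z * pow x (h ∸ 3) * pow y (h ∸ 1)))
        + ((3 *ℕ 2 ^ℕ (m ∸ 2)) · (pow w 2 * pow z 2 * pow x (h ∸ 2) * pow y (h ∸ 2)))
        + (h · (w * pow z 3 * pow x (h ∸ 1) * pow y (h ∸ 3)))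
        + ((2 ^ℕ (m ∸ 3) ∸ 1) · (pow z 4 * pow x h * pow y (h ∸ 4)))
        + pow z 4 * pow y (N ∸ 4)
    J-RM1-independent u₁⊕u₂≢u₃ = ≈-trans (collect-independent n (begin
      J (RM1 m) T w z x y + (term 0 + term 4)
        ≈⟨ J-RM1-split ⟩
      (E₀ + E₄) + ∑[ a ∈ allV m ] termPair (dots a U)
        ≈⟨ +-cong ≈-refl (∑-dots U independent termPair) ⟩
      (E₀ + E₄) + (2 ^ℕ (m ∸ 3)) · (∑[ e ∈ allV 3 ] termPair e)
        ≈⟨ +-cong ≈-refl (·-cong (2^≡suc[2^∸1] (m ∸ 3)) ∑-termPair) ⟩
      (E₀ + E₄) + suc n · ((term 0 + term 4) + (4 · term 1 + 6 · term 2 + 4 · term 3)) ∎))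
      (+-cong (+-cong (+-cong (+-cong (+-cong (+-cong E₀-shape (·-congʳ n term0-shape))
        (·-cong 4c≡h term1-shape)) (·-congˡ _ 6c≡3*2^[m∸2])) (·-cong 4c≡h term3-shape))
        (·-congʳ n term4-shape)) E₄-shape)
      where
      independent = independent-U u₁⊕u₂≢u₃
      3≤m = independent⇒≤ U independent
      n = 2 ^ℕ (m ∸ 3) ∸ 1
      4c≡h : 4 *ℕ suc n ≡ h
      4c≡h = trans (cong (4 *ℕ_) (sym (2^≡suc[2^∸1] (m ∸ 3)))) (4*2^[m∸3]≡2^[m∸1] 3≤m)
      6c≡3*2^[m∸2] : 6 *ℕ suc n ≡ 3 *ℕ 2 ^ℕ (m ∸ 2)
      6c≡3*2^[m∸2] = trans (cong (6 *ℕ_) (sym (2^≡suc[2^∸1] (m ∸ 3)))) (6*2^[m∸3]≡3*2^[m∸2] 3≤m)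

    J-RM1-dependent : u₁ ⊕ u₂ ≡ u₃ →
      J (RM1 m) T w z x y ≈
        pow w 4 * pow x (N ∸ 4)
        + ((2 ^ℕ (m ∸ 2) ∸ 1) · (pow w 4 * pow x (h ∸ 4) * pow y h))
        + ((3 *ℕ 2 ^ℕ (m ∸ 1)) · (pow w 2 * pow z 2 * pow x (h ∸ 2) * pow y (h ∸ 2)))
        + ((2 ^ℕ (m ∸ 2) ∸ 1) · (pow z 4 * pow x h * pow y (h ∸ 4)))
        + pow z 4 * pow y (N ∸ 4)
    J-RM1-dependent u₁⊕u₂≡u₃ = ≈-trans (collect-dependent n (begin
      J (RM1 m) T w z x y + (term 0 + term 4)
        ≈⟨ J-RM1-split ⟩
      (E₀ + E₄) + ∑[ a ∈ allV m ] termPair (dots a U)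
        ≈⟨ +-cong ≈-refl (∑-cong (allV m) (λ a → ≡⇒≈ (cong termPair (dots-U-dependent u₁⊕u₂≡u₃ a)))) ⟩
      (E₀ + E₄) + ∑[ a ∈ allV m ] termPair (appendSum (dots a (u₁ ∷ u₂ ∷ [])))
        ≈⟨ +-cong ≈-refl (∑-dots (u₁ ∷ u₂ ∷ []) independent-u₁u₂ (λ e → termPair (appendSum e))) ⟩
      (E₀ + E₄) + (2 ^ℕ (m ∸ 2)) · (∑[ e ∈ allV 2 ] termPair (appendSum e))
        ≈⟨ +-cong ≈-refl (·-cong (2^≡suc[2^∸1] (m ∸ 2)) ∑-termPair-appendSum) ⟩
      (E₀ + E₄) + suc n · ((term 0 + term 4) + 6 · term 2) ∎))
      (+-cong (+-cong (+-cong (+-cong E₀-shape (·-congʳ n term0-shape)) (·-congˡ _ 6c≡3*2^[m∸1]))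
        (·-congʳ n term4-shape)) E₄-shape)
      where
      2≤m = independent⇒≤ (u₁ ∷ u₂ ∷ []) independent-u₁u₂
      n = 2 ^ℕ (m ∸ 2) ∸ 1
      6c≡3*2^[m∸1] : 6 *ℕ suc n ≡ 3 *ℕ 2 ^ℕ (m ∸ 1)
      6c≡3*2^[m∸1] = trans (cong (6 *ℕ_) (sym (2^≡suc[2^∸1] (m ∸ 2)))) (6*2^[m∸2]≡3*2^[m∸1] 2≤m)

theorem1p1 : ∀ {c ℓ : Level} (R : CommutativeRing c ℓ) (m : ℕ) → 1 ≤ m →
  (u₁ u₂ u₃ : V m) →
  0V m ≢ u₁ → 0V m ≢ u₂ → 0V m ≢ u₃ → u₁ ≢ u₂ → u₁ ≢ u₃ → u₂ ≢ u₃ →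
  let open CommutativeRing R
      open Jacobi R
      T = setT u₁ u₂ u₃
      N = 2 ^ℕ m
      h = 2 ^ℕ (m ∸ 1)
  in (w z x y : Carrier) →
    ((u₁ ⊕ u₂ ≢ u₃ →
        J (RM1 m) T w z x y ≈
          pow w 4 * pow x (N ∸ 4)
          + ((2 ^ℕ (m ∸ 3) ∸ 1) · (pow w 4 * pow x (h ∸ 4) * pow y h))
          + (h · (pow w 3 * z * pow x (h ∸ 3) * pow y (h ∸ 1)))
          + ((3 *ℕ 2 ^ℕ (m ∸ 2)) · (pow w 2 * pow z 2 * pow x (h ∸ 2) * pow y (h ∸ 2)))
          + (h · (w * pow z 3 * pow x (h ∸ 1) * pow y (h ∸ 3)))
          + ((2 ^ℕ (m ∸ 3) ∸ 1) · (pow z 4 * pow x h * pow y (h ∸ 4)))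
          + pow z 4 * pow y (N ∸ 4))
    × (u₁ ⊕ u₂ ≡ u₃ →
        J (RM1 m) T w z x y ≈
          pow w 4 * pow x (N ∸ 4)
          + ((2 ^ℕ (m ∸ 2) ∸ 1) · (pow w 4 * pow x (h ∸ 4) * pow y h))
          + ((3 *ℕ 2 ^ℕ (m ∸ 1)) · (pow w 2 * pow z 2 * pow x (h ∸ 2) * pow y (h ∸ 2)))
          + ((2 ^ℕ (m ∸ 2) ∸ 1) · (pow z 4 * pow x h * pow y (h ∸ 4)))
          + pow z 4 * pow y (N ∸ 4))
    × (u₁ ⊕ u₂ ≢ u₃ →
        (2 ^ℕ (m Data.Nat.+ 1)) · J (dual (RM1 m)) T w z x y ≈
          pow (w + z) 4 * pow (x + y) (N ∸ 4)
          + ((2 ^ℕ (m ∸ 3) ∸ 1) · (pow (w + z) 4 * pow (x + y) (h ∸ 4) * pow (x - y) h))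
          + (h · (pow (w + z) 3 * (w - z) * pow (x + y) (h ∸ 3) * pow (x - y) (h ∸ 1)))
          + ((3 *ℕ 2 ^ℕ (m ∸ 2)) · (pow (w + z) 2 * pow (w - z) 2 * pow (x + y) (h ∸ 2) * pow (x - y) (h ∸ 2)))
          + (h · ((w + z) * pow (w - z) 3 * pow (x + y) (h ∸ 1) * pow (x - y) (h ∸ 3)))
          + ((2 ^ℕ (m ∸ 3) ∸ 1) · (pow (w - z) 4 * pow (x + y) h * pow (x - y) (h ∸ 4)))
          + pow (w - z) 4 * pow (x - y) (N ∸ 4))
    × (u₁ ⊕ u₂ ≡ u₃ →
        (2 ^ℕ (m Data.Nat.+ 1)) · J (dual (RM1 m)) T w z x y ≈
          pow (w + z) 4 * pow (x + y) (N ∸ 4)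
          + ((2 ^ℕ (m ∸ 2) ∸ 1) · (pow (w + z) 4 * pow (x + y) (h ∸ 4) * pow (x - y) h))
          + ((3 *ℕ 2 ^ℕ (m ∸ 1)) · (pow (w + z) 2 * pow (w - z) 2 * pow (x + y) (h ∸ 2) * pow (x - y) (h ∸ 2)))
          + ((2 ^ℕ (m ∸ 2) ∸ 1) · (pow (w - z) 4 * pow (x + y) h * pow (x - y) (h ∸ 4)))
          + pow (w - z) 4 * pow (x - y) (N ∸ 4)))
theorem1p1 R m _ u₁ u₂ u₃ 0≢u₁ 0≢u₂ 0≢u₃ u₁≢u₂ u₁≢u₃ u₂≢u₃ w z x y =
    M.J-RM1-independent R w z x y
  , M.J-RM1-dependent R w z x y
  , (λ u₁⊕u₂≢u₃ → ≈-trans (macWilliams-RM1 m T w z x y)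
                          (M.J-RM1-independent R (w + z) (w - z) (x + y) (x - y) u₁⊕u₂≢u₃))
  , (λ u₁⊕u₂≡u₃ → ≈-trans (macWilliams-RM1 m T w z x y)
                          (M.J-RM1-dependent R (w + z) (w - z) (x + y) (x - y) u₁⊕u₂≡u₃))
  where
  open CommutativeRing R using (_+_; _-_; _≈_) renaming (trans to ≈-trans)
  open FourPoints u₁ u₂ u₃ 0≢u₁ 0≢u₂ 0≢u₃ u₁≢u₂ u₁≢u₃ u₂≢u₃ using (T; module Monomials)
  module M = Monomials
  open MacWilliams R using (macWilliams-RM1)
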